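{- Let $G$ be a connected graph with $n\ge 3$ vertices and $m$ edges, and let $$\epsilon=\frac{n^2-n-2m}{n-2}-\Big\lfloor\frac{n^2-n-2m}{n-2}\Big\rfloor.$$ Then $$\frac{m(m-n+1)}{n-1}\le C(G)\le \frac{n}{(n-2)\epsilon+2}+\frac{mn-n^2+(n-2)\epsilon}{2}.$$ The first inequality is an equality if and only if $G$ is electrically-edge-equivalent. The second inequality is an equality if and only if $G$ is a tree or $G=K_n$.
   Context: All graphs are finite and simple. For a connected graph $G$, regard each edge as a unit resistor. $\Omega_G(i,j)$ is the effective resistance between $i$ and $j$. The global cyclicity index is $$C(G)=\sum_{ij\in E(G)}\Big[\frac{1}{\Omega_G(i,j)}-1\Big].$$ A connected graph $G$ is electrically-edge-equivalent if $\Omega_G(u,v)=\Omega_G(x,y)$ for any two edges $uv,xy\in E(G)$. $K_n$ is the complete graph on $n$ vertices. -}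

module Defs where

open import Data.Bool using (Bool; true; false; if_then_else_)
open import Data.Nat as ℕ using (ℕ; zero; suc)
open import Data.Integer as ℤ using (ℤ)
open import Data.Fin as Fin using (Fin; inject₁; fromℕ; toℕ)
open import Data.Fin.Properties using () renaming (_≟_ to _≟ᶠ_)
open import Data.Rational as ℚ using (ℚ; 0ℚ; 1ℚ; _+_; _-_; _*_; floor; 1/_; ≢-nonZero)
open import Data.Rational.Properties using (_≟_)
open import Data.Product using (Σ; ∃; _×_; _,_)
open import Function.Definitions using (Injective)
open import Relation.Binary.PropositionalEquality using (_≡_)
open import Relation.Nullary using (¬_; yes; no)

record Graph (n : ℕ) : Set where
  field
    adj    : Fin n → Fin n → Bool
    sym    : ∀ i j → adj i j ≡ adj j i
    irrefl : ∀ i → adj i i ≡ false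
open Graph public

module _ {n : ℕ} (G : Graph n) where

  Adj : Fin n → Fin n → Set
  Adj i j = adj G i j ≡ true

  data Walk : Fin n → Fin n → Set where
    [] : ∀ {i} → Walk i i
    _∷_ : ∀ {i k j} → Adj i k → Walk k j → Walk i j

  Connected : Set
  Connected = ∀ i j → Walk i j

  -- a cycle: L+1 ≥ 3 distinct vertices v₀,…,v_L with v_t ~ v_{t+1} and v_L ~ v₀
  HasCycle : Set
  HasCycle = Σ ℕ λ L → (2 ℕ.≤ L) × Σ (Fin (suc L) → Fin n) λ v →
               Injective _≡_ _≡_ v ×
               (∀ (t : Fin L) → Adj (v (inject₁ t)) (v (Fin.suc t))) ×
               Adj (v (fromℕ L)) (v Fin.zero)

  IsTree : Set
  IsTree = Connected × ¬ HasCycle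

  IsComplete : Set
  IsComplete = ∀ i j → ¬ (i ≡ j) → Adj i j

sumℚ : ∀ {n} → (Fin n → ℚ) → ℚ
sumℚ {zero}  f = 0ℚ
sumℚ {suc n} f = f Fin.zero + sumℚ (λ i → f (Fin.suc i))

sumℕ : ∀ {n} → (Fin n → ℕ) → ℕ
sumℕ {zero}  f = 0
sumℕ {suc n} f = f Fin.zero ℕ.+ sumℕ (λ i → f (Fin.suc i))

ℕ→ℚ : ℕ → ℚ
ℕ→ℚ k = ℤ.+ k ℚ./ 1

-- total reciprocal: 1/q for q ≠ 0 (and 0 at 0; never used at 0 below)
invℚ : ℚ → ℚ
invℚ q with q ≟ 0ℚ
... | yes _ = 0ℚ
... | no q≢0 = 1/_ q {{≢-nonZero q≢0}}

-- division of an integer by a natural, a / d (only used with d ≥ 1)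
fracℤ : ℤ → ℕ → ℚ
fracℤ a zero    = 0ℚ
fracℤ a (suc d) = a ℚ./ suc d

module _ {n : ℕ} (G : Graph n) where

  -- indicator of an edge {i,j} with i < j (each edge counted once)
  isEdge< : Fin n → Fin n → Bool
  isEdge< i j = if toℕ i ℕ.<ᵇ toℕ j then adj G i j else false

  edgeCount : ℕ
  edgeCount = sumℕ λ i → sumℕ λ j → if isEdge< i j then 1 else 0

  laplacian : (Fin n → ℚ) → Fin n → ℚ
  laplacian φ k = sumℚ λ j → if adj G k j then φ k - φ j else 0ℚ

  δ : Fin n → Fin n → ℚ
  δ i k with i ≟ᶠ k
  ... | yes _ = 1ℚ
  ... | no _  = 0ℚ

  -- Ω is the effective-resistance function of G (unit resistors):
  -- for all i j, Ω i j is the potential difference φ_i − φ_j of a potential φ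
  -- solving Kirchhoff's equations Lφ = e_i − e_j (unit current in at i, out at j).
  IsEffectiveResistance : (Fin n → Fin n → ℚ) → Set
  IsEffectiveResistance Ω = ∀ i j → ∃ λ (φ : Fin n → ℚ) →
    (∀ k → laplacian φ k ≡ δ i k - δ j k) × Ω i j ≡ φ i - φ j

  cyclicity : (Fin n → Fin n → ℚ) → ℚ
  cyclicity Ω = sumℚ λ i → sumℚ λ j →
    if isEdge< i j then invℚ (Ω i j) - 1ℚ else 0ℚ

  EdgeEquivalent : (Fin n → Fin n → ℚ) → Set
  EdgeEquivalent Ω = ∀ u v x y → Adj G u v → Adj G x y → Ω u v ≡ Ω x y

module Bounds (n m : ℕ) where
  nQ mQ : ℚ
  nQ = ℕ→ℚ n
  mQ = ℕ→ℚ m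

  q : ℚ
  q = fracℤ (ℤ.+ (n ℕ.* n) ℤ.- ℤ.+ n ℤ.- ℤ.+ (2 ℕ.* m)) (n ℕ.∸ 2)

  ε : ℚ
  ε = q - (floor q ℚ./ 1)

  lower : ℚ
  lower = fracℤ (ℤ.+ m ℤ.* (ℤ.+ m ℤ.- ℤ.+ n ℤ.+ ℤ.+ 1)) (n ℕ.∸ 1)

  upper : ℚ
  upper = nQ * invℚ (ℕ→ℚ (n ℕ.∸ 2) * ε + ℕ→ℚ 2)
        + (mQ * nQ - nQ * nQ + ℕ→ℚ (n ℕ.∸ 2) * ε) * (ℤ.+ 1 ℚ./ 2)

module Submission where

-- Write S₁ = Σₑ Ωₑ and S₂ = Σₑ 1/Ωₑ over the m edges, so that C(G) = S₂ - m.  Foster's theorem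
-- S₁ = n - 1 and the Cauchy–Schwarz inequality S₁ S₂ ≥ m² give the lower bound, with equality
-- exactly when all Ωₑ agree.  For the upper bound, the maximum principle for the potentials gives
-- 2/n ≤ Ωₑ ≤ 1 on every edge, so 1/Ωₑ lies below the chord of 1/x through the nodes 2/n, Y/n and 1,
-- where Y = (n - 2)ε + 2.  Summing over the edges, Foster's theorem and the integrality of the
-- number of edges with n Ωₑ > Y give the bound.  Equality puts every edge at a node: Ωₑ = 1 only
-- for edges on no cycle, n Ωₑ = 2 makes both ends adjacent to every vertex, and what survives is
-- a tree (ε = 0, all Ωₑ = 1) or Kₙ (all n Ωₑ = 2).

open import Defs renaming (sym to gsym)
open import Data.Bool using (true; false; if_then_else_; T)
import Data.Bool.Properties as BoolP
open import Data.Unit using (⊤; tt)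
open import Data.Nat as ℕ using (ℕ; zero; suc)
import Data.Nat.Properties as ℕP
import Data.Nat.Coprimality as Cop
open import Data.Integer as ℤ using (ℤ)
import Data.Integer.Properties as ℤP
import Data.Integer.DivMod as ℤD
open import Data.Fin as Fin using (Fin; toℕ; inject₁; fromℕ)
import Data.Fin.Properties as FinP
open import Data.Fin.Properties using () renaming (_≟_ to _≟ᶠ_)
open import Data.Rational as ℚ using (ℚ; 0ℚ; 1ℚ; _+_; _-_; _*_; -_; mkℚ; _≤_; _<_; *≤*; *<*; _/_; _⊔_; floor; toℚᵘ; nonNegative; positive; ≢-nonZero)
open import Data.Rational.Properties
import Data.Rational.Unnormalised as U
import Data.Rational.Unnormalised.Properties as UP
open import Data.Rational.Solver
open import Data.Product using (Σ; _×_; _,_; proj₁; proj₂)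
open import Data.Sum using (_⊎_; inj₁; inj₂)
open import Data.Empty using (⊥; ⊥-elim)
open import Function.Bundles using (_⇔_; mk⇔)
open import Function.Definitions using (Injective)
open import Relation.Binary.PropositionalEquality
open import Relation.Binary.Definitions using (tri<; tri≈; tri>)
open import Relation.Nullary using (¬_; yes; no; Dec)
open import Relation.Nullary.Decidable using (_×-dec_)
open ≡-Reasoning
open +-*-Solver

ℤ→ℚ : ℤ → ℚ
ℤ→ℚ i = i / 1

ℤ→ℚ≡mkℚ : ∀ i → ℤ→ℚ i ≡ mkℚ i 0 (Cop.sym (Cop.1-coprimeTo ℤ.∣ i ∣))
ℤ→ℚ≡mkℚ i = ↥p/↧p≡p (mkℚ i 0 (Cop.sym (Cop.1-coprimeTo ℤ.∣ i ∣)))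

ℤ→ℚ-+ : ∀ a b → ℤ→ℚ (a ℤ.+ b) ≡ ℤ→ℚ a + ℤ→ℚ b
ℤ→ℚ-+ a b rewrite ℤ→ℚ≡mkℚ a | ℤ→ℚ≡mkℚ b =
  trans (ℤ→ℚ≡mkℚ (a ℤ.+ b)) (sym (trans (/-cong {p₁ = a ℤ.* ℤ.+ 1 ℤ.+ b ℤ.* ℤ.+ 1} {q₁ = 1}
     (cong₂ ℤ._+_ (ℤP.*-identityʳ a) (ℤP.*-identityʳ b)) refl) (ℤ→ℚ≡mkℚ (a ℤ.+ b))))

ℤ→ℚ-* : ∀ a b → ℤ→ℚ (a ℤ.* b) ≡ ℤ→ℚ a * ℤ→ℚ b
ℤ→ℚ-* a b rewrite ℤ→ℚ≡mkℚ a | ℤ→ℚ≡mkℚ b = refl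

ℤ→ℚ-neg : ∀ a → ℤ→ℚ (ℤ.- a) ≡ - ℤ→ℚ a
ℤ→ℚ-neg a = begin
    ℤ→ℚ (ℤ.- a)                          ≡⟨ solve 2 (λ x y → x := x :+ y :- y) refl (ℤ→ℚ (ℤ.- a)) (ℤ→ℚ a) ⟩
    ℤ→ℚ (ℤ.- a) + ℤ→ℚ a - ℤ→ℚ a              ≡⟨ cong (_- ℤ→ℚ a) (sym (ℤ→ℚ-+ (ℤ.- a) a)) ⟩
    ℤ→ℚ (ℤ.- a ℤ.+ a) - ℤ→ℚ a              ≡⟨ cong (λ z → ℤ→ℚ z - ℤ→ℚ a) (ℤP.+-inverseˡ a) ⟩
    0ℚ - ℤ→ℚ a                           ≡⟨ +-identityˡ (- ℤ→ℚ a) ⟩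
    - ℤ→ℚ a ∎

ℤ→ℚ-mono-≤ : ∀ {a b} → a ℤ.≤ b → ℤ→ℚ a ≤ ℤ→ℚ b
ℤ→ℚ-mono-≤ {a} {b} p rewrite ℤ→ℚ≡mkℚ a | ℤ→ℚ≡mkℚ b =
  *≤* (subst₂ ℤ._≤_ (sym (ℤP.*-identityʳ a)) (sym (ℤP.*-identityʳ b)) p)

ℤ→ℚ-cancel-≤ : ∀ {a b} → ℤ→ℚ a ≤ ℤ→ℚ b → a ℤ.≤ b
ℤ→ℚ-cancel-≤ {a} {b} p rewrite ℤ→ℚ≡mkℚ a | ℤ→ℚ≡mkℚ b with p
... | *≤* q = subst₂ ℤ._≤_ (ℤP.*-identityʳ a) (ℤP.*-identityʳ b) q

ℤ→ℚ-mono-< : ∀ {a b} → a ℤ.< b → ℤ→ℚ a < ℤ→ℚ b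
ℤ→ℚ-mono-< {a} {b} p rewrite ℤ→ℚ≡mkℚ a | ℤ→ℚ≡mkℚ b =
  *<* (subst₂ ℤ._<_ (sym (ℤP.*-identityʳ a)) (sym (ℤP.*-identityʳ b)) p)

ℤ→ℚ-cancel-< : ∀ {a b} → ℤ→ℚ a < ℤ→ℚ b → a ℤ.< b
ℤ→ℚ-cancel-< {a} {b} p rewrite ℤ→ℚ≡mkℚ a | ℤ→ℚ≡mkℚ b with p
... | *<* q = subst₂ ℤ._<_ (ℤP.*-identityʳ a) (ℤP.*-identityʳ b) q

ℕ→ℚ-+ : ∀ a b → ℕ→ℚ (a ℕ.+ b) ≡ ℕ→ℚ a + ℕ→ℚ b
ℕ→ℚ-+ a b = ℤ→ℚ-+ (ℤ.+ a) (ℤ.+ b)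

ℕ→ℚ-* : ∀ a b → ℕ→ℚ (a ℕ.* b) ≡ ℕ→ℚ a * ℕ→ℚ b
ℕ→ℚ-* a b = trans (cong ℤ→ℚ (ℤP.pos-* a b)) (ℤ→ℚ-* (ℤ.+ a) (ℤ.+ b))

ℕ→ℚ-suc : ∀ a → ℕ→ℚ (suc a) ≡ 1ℚ + ℕ→ℚ a
ℕ→ℚ-suc a = ℕ→ℚ-+ 1 a

ℕ→ℚ-mono-< : ∀ {a b} → a ℕ.< b → ℕ→ℚ a < ℕ→ℚ b
ℕ→ℚ-mono-< {a} {b} p = ℤ→ℚ-mono-< {ℤ.+ a} {ℤ.+ b} (ℤ.+<+ p)

floor-low : ∀ p → ℤ→ℚ (floor p) ≤ p
floor-low (mkℚ a d c) rewrite ℤ→ℚ≡mkℚ (floor (mkℚ a d c)) =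
  *≤* (subst (λ z → (a ℤ./ ℤ.+ suc d) ℤ.* ℤ.+ suc d ℤ.≤ z) (sym (ℤP.*-identityʳ a)) (ℤD.[n/d]*d≤n a (ℤ.+ suc d)))

floor-high : ∀ p → p < ℤ→ℚ (floor p) + 1ℚ
floor-high (mkℚ a d c) = subst (mkℚ a d c <_) (ℤ→ℚ-+ (floor (mkℚ a d c)) (ℤ.+ 1)) h
  where
    k = a ℤ./ ℤ.+ suc d
    h : mkℚ a d c < ℤ→ℚ (k ℤ.+ ℤ.+ 1)
    h rewrite ℤ→ℚ≡mkℚ (k ℤ.+ ℤ.+ 1) = *<* (subst₂ ℤ._<_ (sym (ℤP.*-identityʳ a)) refl lt)
      where
        lt : a ℤ.< (k ℤ.+ ℤ.+ 1) ℤ.* ℤ.+ suc d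
        lt = subst (ℤ._< (k ℤ.+ ℤ.+ 1) ℤ.* ℤ.+ suc d) (sym (ℤD.a≡a%n+[a/n]*n a (ℤ.+ suc d)))
               (subst (ℤ.+ (a ℤ.% ℤ.+ suc d) ℤ.+ k ℤ.* ℤ.+ suc d ℤ.<_)
                  (trans (ℤP.+-comm (ℤ.+ suc d) (k ℤ.* ℤ.+ suc d))
                     (trans (cong (λ z → k ℤ.* ℤ.+ suc d ℤ.+ z) (sym (ℤP.*-identityˡ (ℤ.+ suc d))))
                        (sym (ℤP.*-distribʳ-+ (ℤ.+ suc d) k (ℤ.+ 1)))))
                  (ℤP.+-monoˡ-< (k ℤ.* ℤ.+ suc d) (ℤ.+<+ (ℤD.n%d<d a (ℤ.+ suc d)))))

fracℤ-mul : ∀ a d → fracℤ a (suc d) * ℕ→ℚ (suc d) ≡ ℤ→ℚ a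
fracℤ-mul a d = toℚᵘ-injective (UP.≃-trans (toℚᵘ-homo-* (fracℤ a (suc d)) (ℕ→ℚ (suc d)))
   (UP.≃-trans (UP.*-cong (toℚᵘ-fromℚᵘ (U.mkℚᵘ a d)) (UP.≃-reflexive (cong toℚᵘ (ℤ→ℚ≡mkℚ (ℤ.+ suc d)))))
     (UP.≃-trans (U.*≡* eq) (UP.≃-reflexive (sym (cong toℚᵘ (ℤ→ℚ≡mkℚ a)))))))
  where
    eq : (a ℤ.* ℤ.+ suc d) ℤ.* ℤ.+ 1 ≡ a ℤ.* (ℤ.+ (suc d ℕ.* 1))
    eq = trans (ℤP.*-identityʳ _) (cong (λ s → a ℤ.* ℤ.+ s) (sym (ℕP.*-identityʳ (suc d))))

ℤ→ℚ-- : ∀ a b → ℤ→ℚ (a ℤ.- b) ≡ ℤ→ℚ a - ℤ→ℚ b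
ℤ→ℚ-- a b = trans (ℤ→ℚ-+ a (ℤ.- b)) (cong (ℤ→ℚ a +_) (ℤ→ℚ-neg b))

p≤q⇒0≤q-p : ∀ {a b} → a ≤ b → 0ℚ ≤ b - a
p≤q⇒0≤q-p {a} {b} p = subst (_≤ b - a) (+-inverseʳ a) (+-mono-≤ p (≤-refl { - a}))

0≤q-p⇒p≤q : ∀ {a b} → 0ℚ ≤ b - a → a ≤ b
0≤q-p⇒p≤q {a} {b} p = subst₂ _≤_ (+-identityˡ a) (solve 2 (λ a b → b :- a :+ a := b) refl a b)
                          (+-mono-≤ p (≤-refl {a}))

p<q⇒0<q-p : ∀ {a b} → a < b → 0ℚ < b - a
p<q⇒0<q-p {a} {b} p = subst (_< b - a) (+-inverseʳ a) (+-mono-<-≤ p (≤-refl { - a}))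

0<q-p⇒p<q : ∀ {a b} → 0ℚ < b - a → a < b
0<q-p⇒p<q {a} {b} p = subst₂ _<_ (+-identityˡ a) (solve 2 (λ a b → b :- a :+ a := b) refl a b)
                          (+-mono-<-≤ p (≤-refl {a}))

≤-via-difference : ∀ {a b} e → b - a ≡ e → 0ℚ ≤ e → a ≤ b
≤-via-difference e eq p = 0≤q-p⇒p≤q (subst (0ℚ ≤_) (sym eq) p)

<-via-difference : ∀ {a b} e → b - a ≡ e → 0ℚ < e → a < b
<-via-difference e eq p = 0<q-p⇒p<q (subst (0ℚ <_) (sym eq) p)

nonNeg*nonNeg : ∀ {a b} → 0ℚ ≤ a → 0ℚ ≤ b → 0ℚ ≤ a * b
nonNeg*nonNeg {a} {b} p q = subst (_≤ a * b) (*-zeroʳ a)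
   (*-monoˡ-≤-nonNeg a {{nonNegative p}} q)

pos*pos : ∀ {a b} → 0ℚ < a → 0ℚ < b → 0ℚ < a * b
pos*pos {a} {b} p q = subst (_< a * b) (*-zeroʳ a)
   (*-monoʳ-<-pos a {{positive p}} q)

0≤p*p : ∀ a → 0ℚ ≤ a * a
0≤p*p a with ≤-total 0ℚ a
... | inj₁ p = nonNeg*nonNeg p p
... | inj₂ p = subst (0ℚ ≤_) (solve 1 (λ a → (:- a) :* (:- a) := a :* a) refl a)
                 (nonNeg*nonNeg (neg-antimono-≤ p) (neg-antimono-≤ p))

mulˡ-≤ : ∀ {c a b} → 0ℚ ≤ c → a ≤ b → c * a ≤ c * b
mulˡ-≤ {c} {a} {b} p q = ≤-via-difference (c * (b - a)) (solve 3 (λ c a b → c :* b :- c :* a := c :* (b :- a)) refl c a b)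
                          (nonNeg*nonNeg p (p≤q⇒0≤q-p q))

mul-cancelˡ-≤ : ∀ {c a b} → 0ℚ < c → c * a ≤ c * b → a ≤ b
mul-cancelˡ-≤ {c} {a} {b} p q = *-cancelˡ-≤-pos c {{positive p}} q

pos⇒≢0 : ∀ {a} → 0ℚ < a → ¬ a ≡ 0ℚ
pos⇒≢0 p e = <-irrefl (sym e) p

invℚ-inverseˡ : ∀ x → ¬ x ≡ 0ℚ → invℚ x * x ≡ 1ℚ
invℚ-inverseˡ x ne with x ≟ 0ℚ
... | yes e = ⊥-elim (ne e)
... | no ne' = *-inverseˡ x {{≢-nonZero ne'}}

invℚ-inverseʳ : ∀ x → ¬ x ≡ 0ℚ → x * invℚ x ≡ 1ℚ
invℚ-inverseʳ x ne = trans (*-comm x (invℚ x)) (invℚ-inverseˡ x ne)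

invℚ-pos : ∀ x → 0ℚ < x → 0ℚ < invℚ x
invℚ-pos x p with x ≟ 0ℚ
... | yes e = ⊥-elim (pos⇒≢0 p e)
... | no ne' = positive⁻¹ _ {{1/pos⇒pos x {{positive p}}}}

invℚ-unique : ∀ x y → x * y ≡ 1ℚ → invℚ x ≡ y
invℚ-unique x y e = begin
    invℚ x                 ≡⟨ sym (*-identityʳ (invℚ x)) ⟩
    invℚ x * 1ℚ            ≡⟨ cong (invℚ x *_) (sym e) ⟩
    invℚ x * (x * y)       ≡⟨ sym (*-assoc (invℚ x) x y) ⟩
    invℚ x * x * y         ≡⟨ cong (_* y) (invℚ-inverseˡ x ne) ⟩
    1ℚ * y                 ≡⟨ *-identityˡ y ⟩
    y ∎
  where
    ne : ¬ x ≡ 0ℚ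
    ne x0 = 1≢0 (trans (sym e) (trans (cong (_* y) x0) (*-zeroˡ y)))

mul-cancelˡ-≡ : ∀ {c a b} → ¬ c ≡ 0ℚ → c * a ≡ c * b → a ≡ b
mul-cancelˡ-≡ {c} {a} {b} ne e = begin
    a                     ≡⟨ solve 2 (λ a i → a := a :* con 1ℚ) refl a (invℚ c) ⟩
    a * 1ℚ                ≡⟨ cong (a *_) (sym (invℚ-inverseˡ c ne)) ⟩
    a * (invℚ c * c)      ≡⟨ solve 3 (λ a i c → a :* (i :* c) := i :* (c :* a)) refl a (invℚ c) c ⟩
    invℚ c * (c * a)      ≡⟨ cong (invℚ c *_) e ⟩
    invℚ c * (c * b)      ≡⟨ solve 3 (λ b i c → i :* (c :* b) := b :* (i :* c)) refl b (invℚ c) c ⟩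
    b * (invℚ c * c)      ≡⟨ cong (b *_) (invℚ-inverseˡ c ne) ⟩
    b * 1ℚ                ≡⟨ *-identityʳ b ⟩
    b ∎

p-q≡0⇒p≡q : ∀ {a b} → a - b ≡ 0ℚ → a ≡ b
p-q≡0⇒p≡q {a} {b} e = begin
   a                ≡⟨ solve 2 (λ a b → a := a :- b :+ b) refl a b ⟩
   a - b + b        ≡⟨ cong (_+ b) e ⟩
   0ℚ + b           ≡⟨ +-identityˡ b ⟩
   b ∎

p≡q⇒p-q≡0 : ∀ {a b} → a ≡ b → a - b ≡ 0ℚ
p≡q⇒p-q≡0 {a} refl = +-inverseʳ a

p*p≡0⇒p≡0 : ∀ a → a * a ≡ 0ℚ → a ≡ 0ℚ
p*p≡0⇒p≡0 a e with a ≟ 0ℚ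
... | yes z = z
... | no nz = begin
      a                     ≡⟨ sym (*-identityˡ a) ⟩
      1ℚ * a                ≡⟨ cong (_* a) (sym (invℚ-inverseˡ a nz)) ⟩
      invℚ a * a * a        ≡⟨ *-assoc (invℚ a) a a ⟩
      invℚ a * (a * a)      ≡⟨ cong (invℚ a *_) e ⟩
      invℚ a * 0ℚ           ≡⟨ *-zeroʳ (invℚ a) ⟩
      0ℚ ∎

p*q≡0⇒p≡0 : ∀ {a b} → 0ℚ < b → a * b ≡ 0ℚ → a ≡ 0ℚ
p*q≡0⇒p≡0 {a} {b} pb e = mul-cancelˡ-≡ {c = b} (λ z → <-irrefl (sym z) pb)
  (trans (*-comm b a) (trans e (sym (*-zeroʳ b))))

p*q≡0⇒p≡0⊎q≡0 : ∀ a b → a * b ≡ 0ℚ → a ≡ 0ℚ ⊎ b ≡ 0ℚ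
p*q≡0⇒p≡0⊎q≡0 a b e with a ≟ 0ℚ
... | yes z = inj₁ z
... | no nz = inj₂ (mul-cancelˡ-≡ {c = a} nz (trans e (sym (*-zeroʳ a))))

neg-difference : ∀ a b → - (a - b) ≡ b - a
neg-difference a b = solve 2 (λ a b → :- (a :- b) := b :- a) refl a b

≤∧≢⇒< : ∀ {x y} → x ≤ y → ¬ x ≡ y → x < y
≤∧≢⇒< {x} {y} p q with <-cmp x y
... | tri< l _ _ = l
... | tri≈ _ e _ = ⊥-elim (q e)
... | tri> _ _ g = ⊥-elim (<-irrefl refl (≤-<-trans p g))

≤⇒<⊎≡ : ∀ {a b} → a ≤ b → a < b ⊎ a ≡ b
≤⇒<⊎≡ {a} {b} p with a ≟ b
... | yes eq = inj₂ eq
... | no ne = inj₁ (≤∧≢⇒< p ne)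

p<q⇒p-q<0 : ∀ {a b} → a < b → a - b < 0ℚ
p<q⇒p-q<0 {a} {b} p = <-via-difference (b - a) (solve 2 (λ a b → con 0ℚ :- (a :- b) := b :- a) refl a b) (p<q⇒0<q-p p)

sum-cong : ∀ {n} {f g : Fin n → ℚ} → (∀ i → f i ≡ g i) → sumℚ f ≡ sumℚ g
sum-cong {zero} e = refl
sum-cong {suc n} e = cong₂ _+_ (e Fin.zero) (sum-cong (λ i → e (Fin.suc i)))

sum-0 : ∀ {n} → sumℚ {n} (λ _ → 0ℚ) ≡ 0ℚ
sum-0 {zero} = refl
sum-0 {suc n} = trans (+-identityˡ _) (sum-0 {n})

sum-+ : ∀ {n} (f g : Fin n → ℚ) → sumℚ (λ i → f i + g i) ≡ sumℚ f + sumℚ g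
sum-+ {zero} f g = refl
sum-+ {suc n} f g = begin
  f Fin.zero + g Fin.zero + sumℚ (λ i → f (Fin.suc i) + g (Fin.suc i))
    ≡⟨ cong (f Fin.zero + g Fin.zero +_) (sum-+ (λ i → f (Fin.suc i)) (λ i → g (Fin.suc i))) ⟩
  f Fin.zero + g Fin.zero + (sumℚ (λ i → f (Fin.suc i)) + sumℚ (λ i → g (Fin.suc i)))
    ≡⟨ solve 4 (λ a b c d → a :+ b :+ (c :+ d) := a :+ c :+ (b :+ d)) refl (f Fin.zero) (g Fin.zero) (sumℚ (λ i → f (Fin.suc i))) (sumℚ (λ i → g (Fin.suc i))) ⟩
  f Fin.zero + sumℚ (λ i → f (Fin.suc i)) + (g Fin.zero + sumℚ (λ i → g (Fin.suc i))) ∎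

sum-*ˡ : ∀ {n} (c : ℚ) (f : Fin n → ℚ) → sumℚ (λ i → c * f i) ≡ c * sumℚ f
sum-*ˡ {zero} c f = sym (*-zeroʳ c)
sum-*ˡ {suc n} c f = trans (cong (c * f Fin.zero +_) (sum-*ˡ c (λ i → f (Fin.suc i))))
                           (sym (*-distribˡ-+ c _ _))

sum-*ʳ : ∀ {n} (c : ℚ) (f : Fin n → ℚ) → sumℚ (λ i → f i * c) ≡ sumℚ f * c
sum-*ʳ c f = trans (sum-cong (λ i → *-comm (f i) c)) (trans (sum-*ˡ c f) (*-comm c _))

sum-neg : ∀ {n} (f : Fin n → ℚ) → sumℚ (λ i → - f i) ≡ - sumℚ f
sum-neg f = trans (sum-cong (λ i → solve 1 (λ x → :- x := con (ℚ.- 1ℚ) :* x) refl (f i)))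
            (trans (sum-*ˡ (ℚ.- 1ℚ) f) (solve 1 (λ x → con (ℚ.- 1ℚ) :* x := :- x) refl (sumℚ f)))

sum-- : ∀ {n} (f g : Fin n → ℚ) → sumℚ (λ i → f i - g i) ≡ sumℚ f - sumℚ g
sum-- f g = trans (sum-+ f (λ i → - g i)) (cong (sumℚ f +_) (sum-neg g))

sum-swap : ∀ {m n} (f : Fin m → Fin n → ℚ) →
  sumℚ (λ i → sumℚ (λ j → f i j)) ≡ sumℚ (λ j → sumℚ (λ i → f i j))
sum-swap {zero} {n} f = sym (sum-0 {n})
sum-swap {suc m} {n} f = begin
  sumℚ (λ j → f Fin.zero j) + sumℚ (λ i → sumℚ (λ j → f (Fin.suc i) j))
    ≡⟨ cong (sumℚ (λ j → f Fin.zero j) +_) (sum-swap (λ i j → f (Fin.suc i) j)) ⟩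
  sumℚ (λ j → f Fin.zero j) + sumℚ (λ j → sumℚ (λ i → f (Fin.suc i) j))
    ≡⟨ sym (sum-+ (λ j → f Fin.zero j) (λ j → sumℚ (λ i → f (Fin.suc i) j))) ⟩
  sumℚ (λ j → f Fin.zero j + sumℚ (λ i → f (Fin.suc i) j)) ∎

sum-const : ∀ n (c : ℚ) → sumℚ {n} (λ _ → c) ≡ ℕ→ℚ n * c
sum-const zero c = sym (*-zeroˡ c)
sum-const (suc n) c = begin
  c + sumℚ {n} (λ _ → c)  ≡⟨ cong (c +_) (sum-const n c) ⟩
  c + ℕ→ℚ n * c           ≡⟨ solve 2 (λ c k → c :+ k :* c := (con 1ℚ :+ k) :* c) refl c (ℕ→ℚ n) ⟩
  (1ℚ + ℕ→ℚ n) * c        ≡⟨ cong (_* c) (sym (ℕ→ℚ-suc n)) ⟩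
  ℕ→ℚ (suc n) * c ∎

sum-mono : ∀ {n} {f g : Fin n → ℚ} → (∀ i → f i ≤ g i) → sumℚ f ≤ sumℚ g
sum-mono {zero} h = ≤-refl
sum-mono {suc n} h = +-mono-≤ (h Fin.zero) (sum-mono (λ i → h (Fin.suc i)))

sum-strict : ∀ {n} {f g : Fin n → ℚ} → (∀ i → f i ≤ g i) → ∀ k → f k < g k → sumℚ f < sumℚ g
sum-strict {suc n} h Fin.zero lt = +-mono-<-≤ lt (sum-mono (λ i → h (Fin.suc i)))
sum-strict {suc n} h (Fin.suc k) lt = +-mono-≤-< (h Fin.zero) (sum-strict (λ i → h (Fin.suc i)) k lt)

sum-nonneg : ∀ {n} {f : Fin n → ℚ} → (∀ i → 0ℚ ≤ f i) → 0ℚ ≤ sumℚ f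
sum-nonneg {n} {f} h = subst (λ z → z ≤ sumℚ f) (sum-0 {n}) (sum-mono h)

term≤sum : ∀ {n} {f : Fin n → ℚ} → (∀ i → 0ℚ ≤ f i) → ∀ k → f k ≤ sumℚ f
term≤sum {suc n} {f} h Fin.zero =
  subst (λ z → z ≤ sumℚ f) (+-identityʳ (f Fin.zero))
    (+-mono-≤ (≤-refl {f Fin.zero}) (sum-nonneg (λ i → h (Fin.suc i))))
term≤sum {suc n} {f} h (Fin.suc k) =
  subst (λ z → z ≤ sumℚ f) (+-identityˡ (f (Fin.suc k)))
    (+-mono-≤ (h Fin.zero) (term≤sum (λ i → h (Fin.suc i)) k))

two≤sum : ∀ {n} {f : Fin n → ℚ} → (∀ i → 0ℚ ≤ f i) → ∀ k l → ¬ k ≡ l → f k + f l ≤ sumℚ f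
two≤sum {suc n} h Fin.zero Fin.zero ne = ⊥-elim (ne refl)
two≤sum {suc n} {f} h Fin.zero (Fin.suc l) ne =
  +-mono-≤ (≤-refl {f Fin.zero}) (term≤sum (λ i → h (Fin.suc i)) l)
two≤sum {suc n} {f} h (Fin.suc k) Fin.zero ne =
  subst (λ z → z ≤ sumℚ f) (+-comm (f Fin.zero) (f (Fin.suc k)))
    (+-mono-≤ (≤-refl {f Fin.zero}) (term≤sum (λ i → h (Fin.suc i)) k))
two≤sum {suc n} {f} h (Fin.suc k) (Fin.suc l) ne =
  subst (λ z → z ≤ sumℚ f) (+-identityˡ (f (Fin.suc k) + f (Fin.suc l)))
    (+-mono-≤ (h Fin.zero) (two≤sum (λ i → h (Fin.suc i)) k l (λ e → ne (cong Fin.suc e))))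

sum-eq-pointwise : ∀ {n} {f g : Fin n → ℚ} → (∀ i → f i ≤ g i) → sumℚ f ≡ sumℚ g → ∀ k → f k ≡ g k
sum-eq-pointwise h e k = ≤-antisym (h k) (≮⇒≥ (λ lt → <-irrefl e (sum-strict h k lt)))

argmax : ∀ {n} (f : Fin (suc n) → ℚ) → Σ (Fin (suc n)) λ w → ∀ j → f j ≤ f w
argmax {zero} f = Fin.zero , λ { Fin.zero → ≤-refl }
argmax {suc n} f with argmax (λ i → f (Fin.suc i))
... | w , h with f Fin.zero ≤? f (Fin.suc w)
... | yes p = Fin.suc w , λ { Fin.zero → p ; (Fin.suc j) → h j }
... | no p = Fin.zero , λ { Fin.zero → ≤-refl ; (Fin.suc j) → ≤-trans (h j) (<⇒≤ (≰⇒> p)) }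

argmax-inhabited : ∀ {n} (f : Fin n → ℚ) → Fin n → Σ (Fin n) λ w → ∀ j → f j ≤ f w
argmax-inhabited f Fin.zero = argmax f
argmax-inhabited f (Fin.suc _) = argmax f

-- Graphs, the Laplacian and the maximum principle

two : ℚ
two = ℕ→ℚ 2

0<two : 0ℚ < two
0<two = ℕ→ℚ-mono-< {0} {2} (ℕ.s≤s ℕ.z≤n)

-- δ G does not depend on G; dropping the argument lets its sums be computed by induction on m.
δ' : ∀ {m} → Fin m → Fin m → ℚ
δ' i k with i ≟ᶠ k
... | yes _ = 1ℚ
... | no _ = 0ℚ

δ'-same : ∀ {m} (i : Fin m) → δ' i i ≡ 1ℚ
δ'-same i with i ≟ᶠ i
... | yes _ = refl
... | no ne = ⊥-elim (ne refl)

δ'-diff : ∀ {m} {i k : Fin m} → ¬ i ≡ k → δ' i k ≡ 0ℚ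
δ'-diff {i = i} {k} ne with i ≟ᶠ k
... | yes e = ⊥-elim (ne e)
... | no _ = refl

δG≡δ' : ∀ {n} (G : Graph n) i k → δ G i k ≡ δ' i k
δG≡δ' G i k with i ≟ᶠ k
... | yes e = refl
... | no ne = refl

sum-δ' : ∀ {m} (k : Fin m) → sumℚ (δ' k) ≡ 1ℚ
sum-δ' {suc m} Fin.zero = trans (cong₂ _+_ (δ'-same {suc m} Fin.zero)
     (sum-cong {f = λ j → δ' {suc m} Fin.zero (Fin.suc j)} (λ j → δ'-diff {suc m} {Fin.zero} {Fin.suc j} (λ ()))))
  (trans (cong (1ℚ +_) (sum-0 {m})) (+-identityʳ 1ℚ))
sum-δ' {suc m} (Fin.suc k) = trans (cong₂ _+_ (δ'-diff {suc m} {Fin.suc k} {Fin.zero} (λ ()))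
     (sum-cong {f = λ j → δ' (Fin.suc k) (Fin.suc j)} (λ j → shift j)))
  (trans (+-identityˡ _) (sum-δ' k))
  where
    shift : ∀ j → δ' (Fin.suc k) (Fin.suc j) ≡ δ' k j
    shift j = h (k ≟ᶠ j)
      where
        h : Dec (k ≡ j) → δ' (Fin.suc k) (Fin.suc j) ≡ δ' k j
        h (yes refl) = trans (δ'-same (Fin.suc k)) (sym (δ'-same k))
        h (no ne) = trans (δ'-diff (λ e → ne (FinP.suc-injective e))) (sym (δ'-diff ne))

module _ {n : ℕ} (G : Graph n) where

  δ-same : ∀ i → δ G i i ≡ 1ℚ
  δ-same i with i ≟ᶠ i
  ... | yes _ = refl
  ... | no ne = ⊥-elim (ne refl)

  δ-diff : ∀ {i k} → ¬ i ≡ k → δ G i k ≡ 0ℚ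
  δ-diff {i} {k} ne with i ≟ᶠ k
  ... | yes e = ⊥-elim (ne e)
  ... | no _ = refl

  δ-nonneg : ∀ i k → 0ℚ ≤ δ G i k
  δ-nonneg i k with i ≟ᶠ k
  ... | yes _ = *≤* (ℤ.+≤+ ℕ.z≤n)
  ... | no _ = ≤-refl

  adj⇒≢ : ∀ {u v} → Adj G u v → ¬ u ≡ v
  adj⇒≢ {u} a refl with trans (sym a) (irrefl G u)
  ... | ()

  adj-sym : ∀ {u v} → Adj G u v → Adj G v u
  adj-sym {u} {v} a = trans (gsym G v u) a

  adj? : ∀ i j → Dec (Adj G i j)
  adj? i j = adj G i j BoolP.≟ true

module Laplacian {n : ℕ} (G : Graph n) where

  L : (Fin n → ℚ) → Fin n → ℚ
  L = laplacian G

  current : (Fin n → ℚ) → Fin n → Fin n → ℚ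
  current φ k j = if adj G k j then φ k - φ j else 0ℚ

  L- : ∀ (φ ψ : Fin n → ℚ) k → L (λ x → φ x - ψ x) k ≡ L φ k - L ψ k
  L- φ ψ k = trans (sum-cong pt) (sum-- (current φ k) (current ψ k))
    where
      pt : ∀ j → current (λ x → φ x - ψ x) k j ≡ current φ k j - current ψ k j
      pt j with adj G k j
      ... | true = solve 4 (λ a b c d → (a :- b) :- (c :- d) := (a :- c) :- (b :- d)) refl (φ k) (ψ k) (φ j) (ψ j)
      ... | false = sym (+-inverseʳ 0ℚ)

  L-neg : ∀ (φ : Fin n → ℚ) k → L (λ x → - φ x) k ≡ - L φ k
  L-neg φ k = trans (sum-cong pt) (sum-neg (current φ k))
    where
      pt : ∀ j → current (λ x → - φ x) k j ≡ - current φ k j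
      pt j with adj G k j
      ... | true = solve 2 (λ a b → (:- a) :- (:- b) := :- (a :- b)) refl (φ k) (φ j)
      ... | false = refl

  current-nonneg-at-max : ∀ φ w → (∀ x → φ x ≤ φ w) → ∀ j → 0ℚ ≤ current φ w j
  current-nonneg-at-max φ w h j with adj G w j
  ... | true = p≤q⇒0≤q-p (h j)
  ... | false = ≤-refl

  -- At a maximum every current is ≥ 0, so (Lφ)_w ≤ 0 forces them all to vanish.
  max-spreads : ∀ φ w → (∀ x → φ x ≤ φ w) → L φ w ≤ 0ℚ → ∀ j → Adj G w j → φ j ≡ φ w
  max-spreads φ w h lz j a = sym (p-q≡0⇒p≡q t0)
    where
      teq : current φ w j ≡ 0ℚ
      teq = ≤-antisym (≤-trans (term≤sum (current-nonneg-at-max φ w h) j) lz) (current-nonneg-at-max φ w h j)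
      t0 : φ w - φ j ≡ 0ℚ
      t0 = subst (λ b → (if b then φ w - φ j else 0ℚ) ≡ 0ℚ) a teq

  data WalkWithin (P : Fin n → Set) : Fin n → Fin n → Set where
    [] : ∀ {i} → WalkWithin P i i
    cons : ∀ {i k j} → P i → Adj G i k → WalkWithin P k j → WalkWithin P i j

  WalkWithin-map : ∀ {P Q : Fin n → Set} → (∀ {x} → P x → Q x) → ∀ {i j} → WalkWithin P i j → WalkWithin Q i j
  WalkWithin-map f [] = []
  WalkWithin-map f (cons p a w) = cons (f p) a (WalkWithin-map f w)

  WalkWithin-snoc : ∀ {P i j k} → WalkWithin P i j → P j → Adj G j k → WalkWithin P i k
  WalkWithin-snoc [] p a = cons p a []
  WalkWithin-snoc (cons q b w) p a = cons q b (WalkWithin-snoc w p a)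

  walk⇒WalkWithin : ∀ {i j} → Walk G i j → WalkWithin (λ _ → ⊤) i j
  walk⇒WalkWithin [] = []
  walk⇒WalkWithin (a ∷ w) = cons tt a (walk⇒WalkWithin w)

  max-spreads-along : ∀ φ M t P → (∀ x → φ x ≤ M) → (∀ x → P x → φ x ≡ M → ¬ x ≡ t → L φ x ≤ 0ℚ) →
                      ∀ {w} → φ w ≡ M → WalkWithin P w t → φ t ≡ M
  max-spreads-along φ M t P hM hL e [] = e
  max-spreads-along φ M t P hM hL {w} e (cons {k = k} p a w') with w ≟ᶠ t
  ... | yes refl = e
  ... | no ne = max-spreads-along φ M t P hM hL
                  (trans (max-spreads φ w (λ x → subst (φ x ≤_) (sym e) (hM x)) (hL w p e ne) k a) e) w'

  max-spreads-along-walk : ∀ φ M t → (∀ x → φ x ≤ M) → (∀ x → φ x ≡ M → ¬ x ≡ t → L φ x ≤ 0ℚ) →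
                           ∀ {w} → φ w ≡ M → Walk G w t → φ t ≡ M
  max-spreads-along-walk φ M t hM hL e w =
    max-spreads-along φ M t (λ _ → ⊤) hM (λ x _ → hL x) e (walk⇒WalkWithin w)

  harmonic-const : Connected G → ∀ φ → (∀ k → L φ k ≡ 0ℚ) → ∀ i j → φ i ≡ φ j
  harmonic-const conn φ h i j with argmax-inhabited φ i
  ... | w , hw = trans (at-max i) (sym (at-max j))
    where
      at-max : ∀ x → φ x ≡ φ w
      at-max x = max-spreads-along-walk φ (φ w) x hw (λ y _ _ → ≤-reflexive (h y)) refl (conn w x)

-- Effective resistance

module Resistance {n : ℕ} (G : Graph n) (conn : Connected G) (Ω : Fin n → Fin n → ℚ)
                  (H : IsEffectiveResistance G Ω) where
  open Laplacian G

  pot : Fin n → Fin n → Fin n → ℚ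
  pot i j = proj₁ (H i j)

  L-pot : ∀ i j k → L (pot i j) k ≡ δ G i k - δ G j k
  L-pot i j = proj₁ (proj₂ (H i j))

  Ω≡pot-difference : ∀ i j → Ω i j ≡ pot i j i - pot i j j
  Ω≡pot-difference i j = proj₂ (proj₂ (H i j))

  equal-L⇒constant-difference : ∀ φ ψ → (∀ k → L φ k ≡ L ψ k) → ∀ i j → φ i - ψ i ≡ φ j - ψ j
  equal-L⇒constant-difference φ ψ h = harmonic-const conn (λ x → φ x - ψ x)
    (λ k → trans (L- φ ψ k) (p≡q⇒p-q≡0 (h k)))

  pot≤source : ∀ u v x → pot u v x ≤ pot u v u
  pot≤source u v x with argmax-inhabited (pot u v) u
  ... | w , hw = subst (pot u v x ≤_) (sym (max-spreads-along-walk (pot u v) (pot u v w) u hw cond refl (conn w u))) (hw x)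
    where
      cond : ∀ y → pot u v y ≡ pot u v w → ¬ y ≡ u → L (pot u v) y ≤ 0ℚ
      cond y _ ne = subst (_≤ 0ℚ) (sym (L-pot u v y))
        (subst (λ z → z - δ G v y ≤ 0ℚ) (sym (δ-diff G (λ e → ne (sym e))))
          (subst (_≤ 0ℚ) (sym (+-identityˡ (- δ G v y))) (neg-antimono-≤ (δ-nonneg G v y))))

  sink≤pot : ∀ u v x → pot u v v ≤ pot u v x
  sink≤pot u v x with argmax-inhabited (λ z → - pot u v z) v
  ... | w , hw = neg-cancel (subst (- pot u v x ≤_) (sym (max-spreads-along-walk ψ (ψ w) v hw cond refl (conn w v))) (hw x))
    where
      ψ : Fin n → ℚ
      ψ z = - pot u v z
      neg-cancel : ∀ {a b} → - a ≤ - b → b ≤ a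
      neg-cancel {a} {b} p = subst₂ _≤_ (neg-involutive b) (neg-involutive a) (neg-antimono-≤ p)
        where neg-involutive : ∀ z → - (- z) ≡ z
              neg-involutive z = solve 1 (λ z → :- (:- z) := z) refl z
      cond : ∀ y → ψ y ≡ ψ w → ¬ y ≡ v → L ψ y ≤ 0ℚ
      cond y _ ne = subst (_≤ 0ℚ) (sym (trans (L-neg (pot u v) y) (cong -_ (L-pot u v y))))
        (subst (λ z → - (δ G u y - z) ≤ 0ℚ) (sym (δ-diff G (λ e → ne (sym e))))
          (subst (_≤ 0ℚ) (solve 1 (λ d → :- d := :- (d :- con 0ℚ)) refl (δ G u y)) (neg-antimono-≤ (δ-nonneg G u y))))

  -- Superposing the solutions for currents i → g and g → j gives one for i → j.
  grounded : Fin n → Fin n → Fin n → ℚ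
  grounded g i j = pot i g i - pot j g i - pot i g j + pot j g j

  Ω≡grounded : ∀ g i j → Ω i j ≡ grounded g i j
  Ω≡grounded g i j = begin
      Ω i j                     ≡⟨ Ω≡pot-difference i j ⟩
      φ i - φ j                 ≡⟨ solve 4 (λ a b c d → a :- b := (a :- c) :- (b :- d) :+ (c :- d)) refl (φ i) (φ j) (ψ i) (ψ j) ⟩
      (φ i - ψ i) - (φ j - ψ j) + (ψ i - ψ j)  ≡⟨ cong (λ z → z + (ψ i - ψ j)) (p≡q⇒p-q≡0 (equal-L⇒constant-difference φ ψ hL i j)) ⟩
      0ℚ + (ψ i - ψ j)          ≡⟨ solve 4 (λ a b c d → con 0ℚ :+ ((a :- b) :- (c :- d)) := a :- b :- c :+ d) refl (pot i g i) (pot j g i) (pot i g j) (pot j g j) ⟩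
      grounded g i j ∎
    where
      φ ψ : Fin n → ℚ
      φ = pot i j
      ψ x = pot i g x - pot j g x
      hL : ∀ k → L φ k ≡ L ψ k
      hL k = begin
        L φ k                                   ≡⟨ L-pot i j k ⟩
        δ G i k - δ G j k                       ≡⟨ solve 3 (λ a b c → a :- b := (a :- c) :- (b :- c)) refl (δ G i k) (δ G j k) (δ G g k) ⟩
        (δ G i k - δ G g k) - (δ G j k - δ G g k) ≡⟨ sym (cong₂ _-_ (L-pot i g k) (L-pot j g k)) ⟩
        L (pot i g) k - L (pot j g) k           ≡⟨ sym (L- (pot i g) (pot j g) k) ⟩
        L ψ k ∎

  grounded-sym : ∀ g i j → grounded g i j ≡ grounded g j i
  grounded-sym g i j = solve 4 (λ a b c d → a :- b :- c :+ d := d :- c :- b :+ a) refl (pot i g i) (pot j g i) (pot i g j) (pot j g j)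

  Ω-sym : ∀ i j → Ω i j ≡ Ω j i
  Ω-sym i j = trans (Ω≡grounded i i j) (trans (grounded-sym i i j) (sym (Ω≡grounded i j i)))

  Ω-nonneg : ∀ u v → 0ℚ ≤ Ω u v
  Ω-nonneg u v = subst (0ℚ ≤_) (sym (Ω≡pot-difference u v)) (p≤q⇒0≤q-p (sink≤pot u v u))

  module Edge {u v : Fin n} (a : Adj G u v) where
    φ : Fin n → ℚ
    φ = pot u v
    uv : ¬ u ≡ v
    uv = adj⇒≢ G a

    L-pot-source : L φ u ≡ 1ℚ
    L-pot-source = trans (L-pot u v u) (trans (cong₂ _-_ (δ-same G u) (δ-diff G (λ e → uv (sym e)))) refl)

    L-pot-sink : L φ v ≡ - 1ℚ
    L-pot-sink = trans (L-pot u v v) (trans (cong₂ _-_ (δ-diff G uv) (δ-same G v)) refl)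

    Ω≡pot-drop : Ω u v ≡ φ u - φ v
    Ω≡pot-drop = Ω≡pot-difference u v

    current-nonneg : ∀ j → 0ℚ ≤ current φ u j
    current-nonneg = current-nonneg-at-max φ u (pot≤source u v)

    -- The unit current leaving u is a sum of nonnegative edge currents, one of them Ω u v.
    Ω≤1 : Ω u v ≤ 1ℚ
    Ω≤1 = subst₂ _≤_ tv L-pot-source (term≤sum current-nonneg v)
      where
        tv : current φ u v ≡ Ω u v
        tv = trans (cong (λ b → if b then φ u - φ v else 0ℚ) a) (sym Ω≡pot-drop)

    net-current : Fin n → ℚ
    net-current j = current φ u j - current φ v j

    sum-net-current : sumℚ net-current ≡ two
    sum-net-current = trans (sum-- (current φ u) (current φ v)) (trans (cong₂ _-_ L-pot-source L-pot-sink) refl)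

    -- φ u and φ v are the extreme values of φ, so no vertex draws more than φ u - φ v from {u, v}.
    net-current≤Ω : ∀ j → net-current j ≤ Ω u v
    net-current≤Ω j = subst (net-current j ≤_) (sym Ω≡pot-drop) (h (adj G u j) (adj G v j) refl refl)
      where
        mx : φ j ≤ φ u
        mx = pot≤source u v j
        mn : φ v ≤ φ j
        mn = sink≤pot u v j
        h : ∀ b1 b2 → adj G u j ≡ b1 → adj G v j ≡ b2 → net-current j ≤ φ u - φ v
        h true true e1 e2 rewrite e1 | e2 = ≤-reflexive (solve 3 (λ x y z → (x :- z) :- (y :- z) := x :- y) refl (φ u) (φ v) (φ j))
        h true false e1 e2 rewrite e1 | e2 = ≤-via-difference (φ j - φ v)
              (solve 3 (λ x y z → (x :- y) :- ((x :- z) :- con 0ℚ) := z :- y) refl (φ u) (φ v) (φ j)) (p≤q⇒0≤q-p mn)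
        h false true e1 e2 rewrite e1 | e2 = ≤-via-difference (φ u - φ j)
              (solve 3 (λ x y z → (x :- y) :- (con 0ℚ :- (y :- z)) := x :- z) refl (φ u) (φ v) (φ j)) (p≤q⇒0≤q-p mx)
        h false false e1 e2 rewrite e1 | e2 = subst (_≤ φ u - φ v) (sym (+-inverseʳ 0ℚ)) (p≤q⇒0≤q-p (sink≤pot u v u))

    2≤nΩ : two ≤ ℕ→ℚ n * Ω u v
    2≤nΩ = subst₂ _≤_ sum-net-current (sum-const n (Ω u v)) (sum-mono net-current≤Ω)

    Ω-positive : 0ℚ < Ω u v
    Ω-positive with Ω u v ≟ 0ℚ
    ... | no ne = ≤∧≢⇒< (Ω-nonneg u v) (λ e → ne (sym e))
    ... | yes e = ⊥-elim (<-irrefl refl (<-≤-trans 0<two (subst (two ≤_) (trans (cong (ℕ→ℚ n *_) e) (*-zeroʳ (ℕ→ℚ n))) 2≤nΩ)))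

    net-current≡Ω : ℕ→ℚ n * Ω u v ≡ two → ∀ j → net-current j ≡ Ω u v
    net-current≡Ω e = sum-eq-pointwise net-current≤Ω (trans sum-net-current (trans (sym e) (sym (sum-const n (Ω u v)))))

    L-pot-elsewhere : ∀ j → ¬ j ≡ u → ¬ j ≡ v → L φ j ≡ 0ℚ
    L-pot-elsewhere j nu nv = trans (L-pot u v j) (trans (cong₂ _-_ (δ-diff G (λ e → nu (sym e))) (δ-diff G (λ e → nv (sym e)))) (+-inverseʳ 0ℚ))

    Ω≢0 : ¬ Ω u v ≡ 0ℚ
    Ω≢0 e = <-irrefl (sym e) Ω-positive

    nΩ≡2⇒adj-all : ℕ→ℚ n * Ω u v ≡ two → ∀ j → ¬ j ≡ u → ¬ j ≡ v → Adj G u j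
    nΩ≡2⇒adj-all e j nu nv = h (adj G u j) (adj G v j) refl refl
      where
        cj : net-current j ≡ Ω u v
        cj = net-current≡Ω e j
        h : ∀ b1 b2 → adj G u j ≡ b1 → adj G v j ≡ b2 → Adj G u j
        h true _ e1 _ = e1
        h false true e1 e2 = ⊥-elim (Ω≢0 (trans Ω≡pot-drop (p≡q⇒p-q≡0 (trans (sym φj≡φu) (sym φv≡φj)))))
          where
            cj' : 0ℚ - (φ v - φ j) ≡ φ u - φ v
            cj' = subst (λ z → z ≡ φ u - φ v) (cong₂ (λ b1 b2 → (if b1 then φ u - φ j else 0ℚ) - (if b2 then φ v - φ j else 0ℚ)) e1 e2) (trans cj Ω≡pot-drop)
            φj≡φu : φ j ≡ φ u
            φj≡φu = p-q≡0⇒p≡q (trans (solve 3 (λ a b net-current → net-current :- a := (con 0ℚ :- (b :- net-current))  :- (a :- b)) refl (φ u) (φ v) (φ j)) (p≡q⇒p-q≡0 cj'))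
            φv≡φj : φ v ≡ φ j
            φv≡φj = max-spreads φ j (λ x → subst (φ x ≤_) (sym φj≡φu) (pot≤source u v x)) (≤-reflexive (L-pot-elsewhere j nu nv)) v (adj-sym G e2)
        h false false e1 e2 = ⊥-elim (Ω≢0 (trans (sym cj) c0))
          where
            c0 : net-current j ≡ 0ℚ
            c0 = trans (cong₂ (λ b1 b2 → (if b1 then φ u - φ j else 0ℚ) - (if b2 then φ v - φ j else 0ℚ)) e1 e2) (+-inverseʳ 0ℚ)

    -- If Ω u v = 1 the whole current leaves u through v, so φ z = φ u for every other neighbour z;
    -- the maximum then spreads along any u-avoiding walk from z to v, forcing Ω u v = 0.
    Ω≡1⇒no-detour : Ω u v ≡ 1ℚ → ∀ {z} → Adj G u z → ¬ z ≡ v → WalkWithin (λ w → ¬ w ≡ u) z v → ⊥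
    Ω≡1⇒no-detour e1 {z} az zv w = Ω≢0 (trans Ω≡pot-drop (p≡q⇒p-q≡0 (sym φv≡φu)))
      where
        tv : current φ u v ≡ 1ℚ
        tv = trans (cong (λ b → if b then φ u - φ v else 0ℚ) a) (trans (sym Ω≡pot-drop) e1)
        tz : current φ u z ≡ φ u - φ z
        tz = cong (λ b → if b then φ u - φ z else 0ℚ) az
        two' : 1ℚ + (φ u - φ z) ≤ 1ℚ
        two' = subst₂ _≤_ (cong₂ _+_ tv tz) L-pot-source (two≤sum current-nonneg v z (λ e → zv (sym e)))
        φz≡φu : φ z ≡ φ u
        φz≡φu = ≤-antisym (pot≤source u v z) (0≤q-p⇒p≤q (subst (0ℚ ≤_) (solve 2 (λ a b → (con 1ℚ :+ con 0ℚ) :- (con 1ℚ :+ (a :- b)) := b :- a) refl (φ u) (φ z)) (p≤q⇒0≤q-p two'')))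
          where
            two'' : 1ℚ + (φ u - φ z) ≤ 1ℚ + 0ℚ
            two'' = subst (1ℚ + (φ u - φ z) ≤_) (sym (+-identityʳ 1ℚ)) two'
        φv≡φu : φ v ≡ φ u
        φv≡φu = max-spreads-along φ (φ u) v (λ w → ¬ w ≡ u) (pot≤source u v)
                  (λ x nx _ xv → ≤-reflexive (L-pot-elsewhere x nx xv)) φz≡φu w

module Cycles {n : ℕ} (G : Graph n) (conn : Connected G) (Ω : Fin n → Fin n → ℚ)
              (H : IsEffectiveResistance G Ω) where
  open Laplacian G
  open Resistance G conn Ω H

  path-walk : ∀ L (v : Fin (suc L) → Fin n) → (∀ (s : Fin L) → Adj G (v (inject₁ s)) (v (Fin.suc s))) →
              WalkWithin (λ x → Σ (Fin (suc L)) λ s → x ≡ v s) (v Fin.zero) (v (fromℕ L))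
  path-walk zero v st = []
  path-walk (suc L) v st = cons (Fin.zero , refl) (st Fin.zero)
    (WalkWithin-map (λ { (s , e) → Fin.suc s , e }) (path-walk L (λ s → v (Fin.suc s)) (λ s → st (Fin.suc s))))

  -- The rest of a cycle is a detour for its closing edge and for its first edge.
  module _ (L : ℕ) (v : Fin (suc (suc (suc L))) → Fin n) (inj : Injective _≡_ _≡_ v)
           (st : ∀ (t : Fin (suc (suc L))) → Adj G (v (inject₁ t)) (v (Fin.suc t)))
           (cl : Adj G (v (fromℕ (suc (suc L)))) (v Fin.zero)) where

    v0 v1 vL : Fin n
    v0 = v Fin.zero
    v1 = v (Fin.suc Fin.zero)
    vL = v (fromℕ (suc (suc L)))

    closing-edge-Ω≢1 : Ω v0 vL ≡ 1ℚ → ⊥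
    closing-edge-Ω≢1 e = Edge.Ω≡1⇒no-detour (adj-sym G cl) e (st Fin.zero)
      (λ q → case (inj q))
      (WalkWithin-map (λ { {x} (s , q) r → case' s (inj (trans (sym q) r)) })
         (path-walk (suc L) (λ s → v (Fin.suc s)) (λ s → st (Fin.suc s))))
      where
        case : ¬ Fin.suc Fin.zero ≡ fromℕ (suc (suc L))
        case ()
        case' : ∀ s → ¬ Fin.suc s ≡ Fin.zero
        case' s ()

    first-edge-Ω≢1 : Ω v1 v0 ≡ 1ℚ → ⊥
    first-edge-Ω≢1 e = Edge.Ω≡1⇒no-detour (adj-sym G (st Fin.zero)) e (st (Fin.suc Fin.zero))
      (λ q → case (inj q))
      (WalkWithin-snoc
        (WalkWithin-map (λ { {x} (s , q) r → case' s (inj (trans (sym q) r)) })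
           (path-walk L (λ s → v (Fin.suc (Fin.suc s))) (λ s → st (Fin.suc (Fin.suc s)))))
        (λ r → case'' (inj r)) cl)
      where
        case : ¬ Fin.suc (Fin.suc Fin.zero) ≡ Fin.zero
        case ()
        case' : ∀ s → ¬ Fin.suc (Fin.suc s) ≡ Fin.suc Fin.zero
        case' s ()
        case'' : ¬ fromℕ (suc (suc L)) ≡ Fin.suc Fin.zero
        case'' ()

-- Edges with Ω < 1 lie on a cycle

sumℕ-mono : ∀ {m} {f g : Fin m → ℕ} → (∀ i → f i ℕ.≤ g i) → sumℕ f ℕ.≤ sumℕ g
sumℕ-mono {zero} h = ℕ.z≤n
sumℕ-mono {suc m} h = ℕP.+-mono-≤ (h Fin.zero) (sumℕ-mono (λ i → h (Fin.suc i)))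

sumℕ-strict : ∀ {m} {f g : Fin m → ℕ} → (∀ i → f i ℕ.≤ g i) → ∀ k → f k ℕ.< g k → sumℕ f ℕ.< sumℕ g
sumℕ-strict {suc m} h Fin.zero lt = ℕP.+-mono-<-≤ lt (sumℕ-mono (λ i → h (Fin.suc i)))
sumℕ-strict {suc m} h (Fin.suc k) lt = ℕP.+-mono-≤-< (h Fin.zero) (sumℕ-strict (λ i → h (Fin.suc i)) k lt)

find-pos : ∀ {m} (f : Fin m → ℚ) → (Σ (Fin m) λ j → 0ℚ < f j) ⊎ (∀ j → f j ≤ 0ℚ)
find-pos f with FinP.any? (λ j → 0ℚ <? f j)
... | yes p = inj₁ p
... | no ¬p = inj₂ (λ j → ≮⇒≥ (λ lt → ¬p (j , lt)))

search₂ : ∀ {m} (P : Fin m → Fin m → Set) → (∀ i j → Dec (P i j)) →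
          (Σ (Fin m) λ i → Σ (Fin m) λ j → P i j) ⊎ (∀ i j → ¬ P i j)
search₂ P d with FinP.any? (λ i → FinP.any? (d i))
... | yes (i , j , p) = inj₁ (i , j , p)
... | no ¬p = inj₂ (λ i j p → ¬p (i , j , p))

b2n : ∀ {A : Set} → Dec A → ℕ
b2n (yes _) = 1
b2n (no _) = 0

b2n-mono : ∀ {A B : Set} (d : Dec A) (e : Dec B) → (A → B) → b2n d ℕ.≤ b2n e
b2n-mono (yes a) (yes b) f = ℕP.≤-refl
b2n-mono (yes a) (no b) f = ⊥-elim (b (f a))
b2n-mono (no a) e f = ℕ.z≤n

b2n-strict : ∀ {A B : Set} (d : Dec A) (e : Dec B) → ¬ A → B → b2n d ℕ.< b2n e
b2n-strict (yes a) e na b = ⊥-elim (na a)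
b2n-strict (no a) (yes _) na b = ℕP.≤-refl
b2n-strict (no a) (no nb) na b = ⊥-elim (nb b)

module DescendingPaths {n : ℕ} (G : Graph n) (conn : Connected G) (Ω : Fin n → Fin n → ℚ)
                       (H : IsEffectiveResistance G Ω) where
  open Laplacian G
  open Resistance G conn Ω H

  module _ {u t : Fin n} (a : Adj G u t) where
    open Edge a

    -- A path from x to t along which the potential φ = pot u t strictly decreases;
    -- its vertices are therefore distinct.
    data Descent : Fin n → Set where
      end : Descent t
      step : ∀ {x y} → Adj G x y → φ y < φ x → Descent y → Descent x

    length : ∀ {x} → Descent x → ℕ
    length end = 0
    length (step _ _ p) = suc (length p)

    vertex : ∀ {x} (p : Descent x) → Fin (suc (length p)) → Fin n
    vertex end _ = t
    vertex {x} (step _ _ p) Fin.zero = x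
    vertex (step _ _ p) (Fin.suc s) = vertex p s

    vertex-last : ∀ {x} (p : Descent x) → vertex p (fromℕ (length p)) ≡ t
    vertex-last end = refl
    vertex-last (step _ _ p) = vertex-last p

    vertex-zero : ∀ {x} (p : Descent x) → vertex p Fin.zero ≡ x
    vertex-zero end = refl
    vertex-zero (step _ _ p) = refl

    vertex-steps : ∀ {x} (p : Descent x) (s : Fin (length p)) → Adj G (vertex p (inject₁ s)) (vertex p (Fin.suc s))
    vertex-steps (step a p end) Fin.zero = a
    vertex-steps (step a _ (step a' lt' p)) Fin.zero = a
    vertex-steps (step _ _ p) (Fin.suc s) = vertex-steps p s

    vertex-below : ∀ {x} (p : Descent x) s → φ (vertex p s) ≤ φ x
    vertex-below end Fin.zero = ≤-refl
    vertex-below (step _ _ p) Fin.zero = ≤-refl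
    vertex-below (step _ lt p) (Fin.suc s) = ≤-trans (vertex-below p s) (<⇒≤ lt)

    vertex-injective : ∀ {x} (p : Descent x) → Injective _≡_ _≡_ (vertex p)
    vertex-injective end {Fin.zero} {Fin.zero} e = refl
    vertex-injective (step _ _ p) {Fin.zero} {Fin.zero} e = refl
    vertex-injective {x} (step _ lt p) {Fin.zero} {Fin.suc s} e =
      ⊥-elim (<-irrefl refl (≤-<-trans (subst (λ z → φ z ≤ _) (sym e) (vertex-below p s)) lt))
    vertex-injective {x} (step _ lt p) {Fin.suc s} {Fin.zero} e =
      ⊥-elim (<-irrefl refl (≤-<-trans (subst (λ z → φ z ≤ _) e (vertex-below p s)) lt))
    vertex-injective (step _ _ p) {Fin.suc s} {Fin.suc s'} e = cong Fin.suc (vertex-injective p e)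

    below : Fin n → Fin n → ℕ
    below x y = b2n (φ y <? φ x)

    #below : Fin n → ℕ
    #below x = sumℕ (below x)

    #below-decreases : ∀ {x y} → φ y < φ x → #below y ℕ.< #below x
    #below-decreases {x} {y} lt = sumℕ-strict (λ z → b2n-mono (φ z <? φ y) (φ z <? φ x) (λ p → <-trans p lt))
                           y (b2n-strict (φ y <? φ y) (φ y <? φ x) (<-irrefl refl) lt)

    current-pos⇒descent : ∀ x j → 0ℚ < current φ x j → Adj G x j × φ j < φ x
    current-pos⇒descent x j p with adj G x j in eq
    ... | true = refl , 0<q-p⇒p<q p
    ... | false = ⊥-elim (<-irrefl refl p)

    module CycleThroughEdge (lt1 : Ω u t < 1ℚ) where
      -- Off {u, t}, φ is harmonic, so a vertex with a higher neighbour also has a lower one.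
      -- The fuel f bounds #below, which strictly decreases along the descent.
      descend : ∀ f x → #below x ℕ.< f → φ x < φ u → (Σ (Fin n) λ p → Adj G x p × φ x < φ p) → Descent x
      descend zero x () _ _
      descend (suc f) x c lx (p , ap , lp) with x ≟ᶠ t
      ... | yes refl = end
      ... | no xt with find-pos (current φ x)
      ... | inj₁ (j , pos) = step (proj₁ tp) (proj₂ tp)
              (descend f j (ℕP.<-≤-trans (#below-decreases (proj₂ tp)) (ℕP.≤-pred c)) (<-trans (proj₂ tp) lx)
                     (x , adj-sym G (proj₁ tp) , proj₂ tp))
        where
          tp : Adj G x j × φ j < φ x
          tp = current-pos⇒descent x j pos
      ... | inj₂ allle = ⊥-elim (<-irrefl L0 (subst (sumℚ (current φ x) <_) (sum-0 {n}) (sum-strict allle p tp<0)))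
        where
          L0 : L φ x ≡ 0ℚ
          L0 = L-pot-elsewhere x (λ e → <-irrefl (cong φ e) lx) xt
          tp<0 : current φ x p < 0ℚ
          tp<0 = subst (λ b → (if b then φ x - φ p else 0ℚ) < 0ℚ) (sym ap) (p<q⇒p-q<0 lp)

      mask : ∀ {A : Set} → Dec A → ℚ → ℚ
      mask (yes _) _ = 0ℚ
      mask (no _) x = x

      mask-pos : ∀ {A : Set} (d : Dec A) {x} → 0ℚ < mask d x → ¬ A × 0ℚ < x
      mask-pos (yes _) p = ⊥-elim (<-irrefl refl p)
      mask-pos (no na) p = na , p

      mask-no : ∀ {A : Set} (d : Dec A) {x} → ¬ A → mask d x ≡ x
      mask-no (yes a) na = ⊥-elim (na a)
      mask-no (no _) na = refl

      current-ut : current φ u t ≡ Ω u t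
      current-ut = trans (cong (λ b → if b then φ u - φ t else 0ℚ) a) (sym Ω≡pot-drop)

      -- Ω u t < 1 means some current leaves u other than through t.
      first-step : Σ (Fin n) λ j → Adj G u j × ¬ j ≡ t × φ j < φ u
      first-step with find-pos (λ j → mask (j ≟ᶠ t) (current φ u j))
      ... | inj₁ (j , pos) with mask-pos (j ≟ᶠ t) pos
      ... | jt , pos' = j , proj₁ (current-pos⇒descent u j pos') , jt , proj₂ (current-pos⇒descent u j pos')
      first-step | inj₂ h = ⊥-elim (<-irrefl refl (≤-<-trans le lt1))
        where
          pt : ∀ j → current φ u j ≤ δ' t j * Ω u t
          pt j with t ≟ᶠ j
          ... | yes refl = subst (current φ u t ≤_) (sym (*-identityˡ (Ω u t))) (≤-reflexive current-ut)
          ... | no ne = subst (current φ u j ≤_) (sym (*-zeroˡ (Ω u t)))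
                          (subst (_≤ 0ℚ) (mask-no (j ≟ᶠ t) (λ e → ne (sym e))) (h j))
          le : 1ℚ ≤ Ω u t
          le = subst₂ _≤_ L-pot-source (trans (sum-*ʳ (Ω u t) (δ' t)) (trans (cong (_* Ω u t) (sum-δ' t)) (*-identityˡ (Ω u t))))
                 (sum-mono pt)

      length-pos : ∀ {x} → ¬ x ≡ t → (p : Descent x) → 1 ℕ.≤ length p
      length-pos nx end = ⊥-elim (nx refl)
      length-pos nx (step _ _ p) = ℕ.s≤s ℕ.z≤n

      j1 : Fin n
      j1 = proj₁ first-step

      a1 : Adj G u j1
      a1 = proj₁ (proj₂ first-step)

      j1t : ¬ j1 ≡ t
      j1t = proj₁ (proj₂ (proj₂ first-step))

      l1 : φ j1 < φ u
      l1 = proj₂ (proj₂ (proj₂ first-step))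

      rest : Descent j1
      rest = descend (suc (#below j1)) j1 ℕP.≤-refl l1 (u , adj-sym G a1 , l1)

      P : Descent u
      P = step a1 l1 rest

      2≤length : 2 ℕ.≤ length P
      2≤length = ℕ.s≤s (length-pos j1t rest)

      edge-on-cycle : HasCycle G
      edge-on-cycle = length P , 2≤length , vertex P , vertex-injective P , vertex-steps P ,
            subst₂ (Adj G) (sym (vertex-last P)) (sym (vertex-zero P)) (adj-sym G a)

      open Cycles G conn Ω H using (first-edge-Ω≢1)

      second-edge-Ω≢1′ : ∀ {x} (b : Adj G u x) (lx : φ x < φ u) → ¬ x ≡ t → (Q : Descent x) → Ω x u ≡ 1ℚ → ⊥
      second-edge-Ω≢1′ b lx nx end e = nx refl
      second-edge-Ω≢1′ b lx nx (step b' l' Q) e =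
        first-edge-Ω≢1 (length Q) (vertex (step b lx (step b' l' Q))) (vertex-injective (step b lx (step b' l' Q)))
          (vertex-steps (step b lx (step b' l' Q)))
          (subst (λ z → Adj G z u) (sym (vertex-last Q)) (adj-sym G a)) e

      second-edge-Ω≢1 : Ω j1 u ≡ 1ℚ → ⊥
      second-edge-Ω≢1 = second-edge-Ω≢1′ a1 l1 j1t rest

-- Sums over edges: Foster's theorem and the Cauchy–Schwarz inequality

T⇒≡ : ∀ {b} → T b → b ≡ true
T⇒≡ {true} _ = refl

¬T⇒≡ : ∀ {b} → ¬ T b → b ≡ false
¬T⇒≡ {true} h = ⊥-elim (h tt)
¬T⇒≡ {false} _ = refl

<ᵇ-asym : ∀ {m n} → m ℕ.< n → ¬ T (n ℕ.<ᵇ m)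
<ᵇ-asym {m} {n} lt t = ℕP.<-asym lt (ℕP.<ᵇ⇒< n m t)

ℕ→ℚ-sumℕ : ∀ {m} (f : Fin m → ℕ) → ℕ→ℚ (sumℕ f) ≡ sumℚ (λ i → ℕ→ℚ (f i))
ℕ→ℚ-sumℕ {zero} f = refl
ℕ→ℚ-sumℕ {suc m} f = trans (ℕ→ℚ-+ (f Fin.zero) _) (cong (ℕ→ℚ (f Fin.zero) +_) (ℕ→ℚ-sumℕ (λ i → f (Fin.suc i))))

module EdgeSum {n : ℕ} (G : Graph n) where

  edgeSum : (Fin n → Fin n → ℚ) → ℚ
  edgeSum h = sumℚ λ i → sumℚ λ j → if isEdge< G i j then h i j else 0ℚ

  arcSum : (Fin n → Fin n → ℚ) → ℚ
  arcSum h = sumℚ λ i → sumℚ λ j → if adj G i j then h i j else 0ℚ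

  edgeSum-pair : ∀ (h : Fin n → Fin n → ℚ) → (∀ i j → h i j ≡ h j i) → ∀ i j →
       (if isEdge< G i j then h i j else 0ℚ) + (if isEdge< G j i then h j i else 0ℚ) ≡ (if adj G i j then h i j else 0ℚ)
  edgeSum-pair h hs i j with ℕP.<-cmp (toℕ i) (toℕ j)
  ... | tri< lt _ _ rewrite T⇒≡ (ℕP.<⇒<ᵇ lt) | ¬T⇒≡ (<ᵇ-asym lt) = +-identityʳ _
  ... | tri> _ _ gt rewrite T⇒≡ (ℕP.<⇒<ᵇ gt) | ¬T⇒≡ (<ᵇ-asym gt) | gsym G j i =
        trans (+-identityˡ _) (cong (λ z → if adj G i j then z else 0ℚ) (sym (hs i j)))
  ... | tri≈ _ e _ rewrite FinP.toℕ-injective {i = i} {j = j} e | ¬T⇒≡ {toℕ j ℕ.<ᵇ toℕ j} (λ t → ℕP.<-irrefl refl (ℕP.<ᵇ⇒< (toℕ j) (toℕ j) t)) | irrefl G j = +-identityˡ 0ℚ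

  edgeSum-twice : ∀ (h : Fin n → Fin n → ℚ) → (∀ i j → h i j ≡ h j i) → edgeSum h + edgeSum h ≡ arcSum h
  edgeSum-twice h hs = begin
    edgeSum h + edgeSum h   ≡⟨ cong (edgeSum h +_) (sum-swap (λ i j → if isEdge< G i j then h i j else 0ℚ)) ⟩
    edgeSum h + sumℚ (λ i → sumℚ λ j → if isEdge< G j i then h j i else 0ℚ)
                  ≡⟨ sym (sum-+ (λ i → sumℚ (λ j → if isEdge< G i j then h i j else 0ℚ)) (λ i → sumℚ (λ j → if isEdge< G j i then h j i else 0ℚ))) ⟩
    sumℚ (λ i → sumℚ (λ j → if isEdge< G i j then h i j else 0ℚ) + sumℚ (λ j → if isEdge< G j i then h j i else 0ℚ))
                  ≡⟨ sum-cong (λ i → sym (sum-+ (λ j → if isEdge< G i j then h i j else 0ℚ) (λ j → if isEdge< G j i then h j i else 0ℚ))) ⟩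
    sumℚ (λ i → sumℚ (λ j → (if isEdge< G i j then h i j else 0ℚ) + (if isEdge< G j i then h j i else 0ℚ)))
                  ≡⟨ sum-cong (λ i → sum-cong (λ j → edgeSum-pair h hs i j)) ⟩
    arcSum h ∎

  isEdge⇒adj : ∀ i j → isEdge< G i j ≡ true → Adj G i j
  isEdge⇒adj i j e with toℕ i ℕ.<ᵇ toℕ j
  ... | true = e
  ... | false = ⊥-elim (case e)
    where case : false ≡ true → ⊥
          case ()

  edgeSum-cong : ∀ h h' → (∀ i j → Adj G i j → h i j ≡ h' i j) → edgeSum h ≡ edgeSum h'
  edgeSum-cong h h' k = sum-cong λ i → sum-cong λ j → pw i j (isEdge< G i j) refl
    where
      pw : ∀ i j b → isEdge< G i j ≡ b → (if b then h i j else 0ℚ) ≡ (if b then h' i j else 0ℚ)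
      pw i j true e = k i j (isEdge⇒adj i j e)
      pw i j false e = refl

  edgeSum-+ : ∀ h h' → edgeSum (λ i j → h i j + h' i j) ≡ edgeSum h + edgeSum h'
  edgeSum-+ h h' = trans (sum-cong λ i → trans (sum-cong λ j → pw (isEdge< G i j) (h i j) (h' i j))
                  (sum-+ (λ j → if isEdge< G i j then h i j else 0ℚ) (λ j → if isEdge< G i j then h' i j else 0ℚ)))
              (sum-+ (λ i → sumℚ λ j → if isEdge< G i j then h i j else 0ℚ) (λ i → sumℚ λ j → if isEdge< G i j then h' i j else 0ℚ))
    where
      pw : ∀ b x y → (if b then x + y else 0ℚ) ≡ (if b then x else 0ℚ) + (if b then y else 0ℚ)
      pw true x y = refl
      pw false x y = sym (+-identityˡ 0ℚ)

  edgeSum-*ˡ : ∀ c h → edgeSum (λ i j → c * h i j) ≡ c * edgeSum h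
  edgeSum-*ˡ c h = trans (sum-cong λ i → trans (sum-cong λ j → pw (isEdge< G i j) (h i j)) (sum-*ˡ c (λ j → if isEdge< G i j then h i j else 0ℚ)))
                 (sum-*ˡ c (λ i → sumℚ λ j → if isEdge< G i j then h i j else 0ℚ))
    where
      pw : ∀ b x → (if b then c * x else 0ℚ) ≡ c * (if b then x else 0ℚ)
      pw true x = refl
      pw false x = sym (*-zeroʳ c)

  edgeSum-neg : ∀ h → edgeSum (λ i j → - h i j) ≡ - edgeSum h
  edgeSum-neg h = trans (edgeSum-cong _ _ (λ i j _ → solve 1 (λ x → :- x := con (- 1ℚ) :* x) refl (h i j)))
             (trans (edgeSum-*ˡ (- 1ℚ) h) (solve 1 (λ x → con (- 1ℚ) :* x := :- x) refl (edgeSum h)))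

  edgeSum-- : ∀ h h' → edgeSum (λ i j → h i j - h' i j) ≡ edgeSum h - edgeSum h'
  edgeSum-- h h' = trans (edgeSum-+ h (λ i j → - h' i j)) (cong (edgeSum h +_) (edgeSum-neg h'))

  edgeSum-mono : ∀ h h' → (∀ i j → Adj G i j → h i j ≤ h' i j) → edgeSum h ≤ edgeSum h'
  edgeSum-mono h h' k = sum-mono λ i → sum-mono λ j → pw i j (isEdge< G i j) refl
    where
      pw : ∀ i j b → isEdge< G i j ≡ b → (if b then h i j else 0ℚ) ≤ (if b then h' i j else 0ℚ)
      pw i j true e = k i j (isEdge⇒adj i j e)
      pw i j false e = ≤-refl

  edgeCount≡ : ℕ→ℚ (edgeCount G) ≡ edgeSum (λ _ _ → 1ℚ)
  edgeCount≡ = trans (ℕ→ℚ-sumℕ (λ i → sumℕ λ j → if isEdge< G i j then 1 else 0)) (sum-cong λ i → trans (ℕ→ℚ-sumℕ (λ j → if isEdge< G i j then 1 else 0)) (sum-cong λ j → pw (isEdge< G i j)))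
    where
      pw : ∀ b → ℕ→ℚ (if b then 1 else 0) ≡ (if b then 1ℚ else 0ℚ)
      pw true = refl
      pw false = refl

  edgeSum-0 : edgeSum (λ _ _ → 0ℚ) ≡ 0ℚ
  edgeSum-0 = trans (sum-cong (λ i → trans (sum-cong (λ j → pw (isEdge< G i j))) (sum-0 {n}))) (sum-0 {n})
    where
      pw : ∀ b → (if b then 0ℚ else 0ℚ) ≡ 0ℚ
      pw true = refl
      pw false = refl

  edgeSum-linear₃ : ∀ a b c f h k → edgeSum (λ i j → a * f i j + b * h i j - c * k i j) ≡ a * edgeSum f + b * edgeSum h - c * edgeSum k
  edgeSum-linear₃ a b c f h k = begin
    edgeSum (λ i j → a * f i j + b * h i j - c * k i j)
      ≡⟨ edgeSum-- (λ i j → a * f i j + b * h i j) (λ i j → c * k i j) ⟩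
    edgeSum (λ i j → a * f i j + b * h i j) - edgeSum (λ i j → c * k i j)
      ≡⟨ cong₂ _-_ (edgeSum-+ (λ i j → a * f i j) (λ i j → b * h i j)) (edgeSum-*ˡ c k) ⟩
    edgeSum (λ i j → a * f i j) + edgeSum (λ i j → b * h i j) - c * edgeSum k
      ≡⟨ cong₂ (λ z w → z + w - c * edgeSum k) (edgeSum-*ˡ a f) (edgeSum-*ˡ b h) ⟩
    a * edgeSum f + b * edgeSum h - c * edgeSum k ∎

  edgeSum-nonneg : ∀ h → (∀ i j → Adj G i j → 0ℚ ≤ h i j) → 0ℚ ≤ edgeSum h
  edgeSum-nonneg h k = subst (_≤ edgeSum h) edgeSum-0 (edgeSum-mono (λ _ _ → 0ℚ) h k)

  edgeSum≡0⇒zero : ∀ h → (∀ i j → Adj G i j → 0ℚ ≤ h i j) → edgeSum h ≡ 0ℚ → ∀ i j → isEdge< G i j ≡ true → h i j ≡ 0ℚ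
  edgeSum≡0⇒zero h k z i j e = ≤-antisym le (subst (0ℚ ≤_) (fij) (f-nn i j))
    where
      f : Fin n → Fin n → ℚ
      f i j = if isEdge< G i j then h i j else 0ℚ
      f-nn : ∀ i j → 0ℚ ≤ f i j
      f-nn i j = pw (isEdge< G i j) refl
        where pw : ∀ b → isEdge< G i j ≡ b → 0ℚ ≤ (if b then h i j else 0ℚ)
              pw true e = k i j (isEdge⇒adj i j e)
              pw false e = ≤-refl
      fij : f i j ≡ h i j
      fij = cong (λ b → if b then h i j else 0ℚ) e
      le : h i j ≤ 0ℚ
      le = subst₂ _≤_ fij z (≤-trans (term≤sum (f-nn i) j) (term≤sum (λ i' → sum-nonneg (f-nn i')) i))

  edgeSum-linear₄ : ∀ a b c d f h k' l → edgeSum (λ i j → a * f i j + b * h i j - c * k' i j + d * l i j) ≡ a * edgeSum f + b * edgeSum h - c * edgeSum k' + d * edgeSum l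
  edgeSum-linear₄ a b c d f h k' l = begin
    edgeSum (λ i j → a * f i j + b * h i j - c * k' i j + d * l i j)
      ≡⟨ edgeSum-+ (λ i j → a * f i j + b * h i j - c * k' i j) (λ i j → d * l i j) ⟩
    edgeSum (λ i j → a * f i j + b * h i j - c * k' i j) + edgeSum (λ i j → d * l i j)
      ≡⟨ cong₂ _+_ (edgeSum-linear₃ a b c f h k') (edgeSum-*ˡ d l) ⟩
    a * edgeSum f + b * edgeSum h - c * edgeSum k' + d * edgeSum l ∎

  edgeSum-1- : ∀ c f → edgeSum (λ i j → c * 1ℚ - c * f i j) ≡ c * (edgeSum (λ _ _ → 1ℚ) - edgeSum f)
  edgeSum-1- c f = trans (edgeSum-- (λ i j → c * 1ℚ) (λ i j → c * f i j))
                (trans (cong₂ _-_ (edgeSum-*ˡ c (λ _ _ → 1ℚ)) (edgeSum-*ˡ c f))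
                  (solve 3 (λ c m p → c :* m :- c :* p := c :* (m :- p)) refl c (edgeSum (λ _ _ → 1ℚ)) (edgeSum f)))

  orientation : ∀ {u v} → Adj G u v → Σ (Fin n) λ a → Σ (Fin n) λ b → isEdge< G a b ≡ true × ((a ≡ u × b ≡ v) ⊎ (a ≡ v × b ≡ u))
  orientation {u} {v} ad with ℕP.<-cmp (toℕ u) (toℕ v)
  ... | tri< lt _ _ = u , v , trans (cong (λ c → if c then adj G u v else false) (T⇒≡ (ℕP.<⇒<ᵇ lt))) ad , inj₁ (refl , refl)
  ... | tri> _ _ gt = v , u , trans (cong (λ c → if c then adj G v u else false) (T⇒≡ (ℕP.<⇒<ᵇ gt))) (adj-sym G ad) , inj₂ (refl , refl)
  ... | tri≈ _ e _ = ⊥-elim (adj⇒≢ G ad (FinP.toℕ-injective e))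

  edgeSum-two-terms : ∀ h → (∀ i j → Adj G i j → 0ℚ ≤ h i j) → ∀ a b a' b' → isEdge< G a b ≡ true → isEdge< G a' b' ≡ true →
           ¬ (a ≡ a' × b ≡ b') → h a b + h a' b' ≤ edgeSum h
  edgeSum-two-terms h k a b a' b' e e' ne = res
    where
      f : Fin n → Fin n → ℚ
      f i j = if isEdge< G i j then h i j else 0ℚ
      f-nn : ∀ i j → 0ℚ ≤ f i j
      f-nn i j = pw (isEdge< G i j) refl
        where pw : ∀ c → isEdge< G i j ≡ c → 0ℚ ≤ (if c then h i j else 0ℚ)
              pw true e = k i j (isEdge⇒adj i j e)
              pw false e = ≤-refl
      fab : f a b ≡ h a b
      fab = cong (λ c → if c then h a b else 0ℚ) e
      fab' : f a' b' ≡ h a' b'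
      fab' = cong (λ c → if c then h a' b' else 0ℚ) e'
      row-nn : ∀ i → 0ℚ ≤ sumℚ (f i)
      row-nn i = sum-nonneg (f-nn i)
      res : h a b + h a' b' ≤ edgeSum h
      res with a FinP.≟ a'
      ... | yes refl = subst₂ _≤_ (cong₂ _+_ fab fab') refl
            (≤-trans (two≤sum (f-nn a) b b' (λ eb → ne (refl , eb))) (term≤sum row-nn a))
      ... | no na = subst₂ _≤_ (cong₂ _+_ fab fab') refl
            (≤-trans (+-mono-≤ (term≤sum (f-nn a) b) (term≤sum (f-nn a') b')) (two≤sum row-nn a a' na))

  edgeSum-affine : ∀ a b c f h → edgeSum (λ i j → a * 1ℚ + b * f i j + c * h i j) ≡ a * edgeSum (λ _ _ → 1ℚ) + b * edgeSum f + c * edgeSum h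
  edgeSum-affine a b c f h = trans (edgeSum-+ (λ i j → a * 1ℚ + b * f i j) (λ i j → c * h i j))
    (cong₂ _+_ (trans (edgeSum-+ (λ i j → a * 1ℚ) (λ i j → b * f i j)) (cong₂ _+_ (edgeSum-*ˡ a (λ _ _ → 1ℚ)) (edgeSum-*ˡ b f))) (edgeSum-*ˡ c h))

module Foster {n : ℕ} (G : Graph n) (conn : Connected G) (Ω : Fin n → Fin n → ℚ)
              (H : IsEffectiveResistance G Ω) (g : Fin n) where
  open Laplacian G
  open Resistance G conn Ω H
  open EdgeSum G

  ψ : Fin n → Fin n → ℚ
  ψ k = pot k g

  sum-L-grounded : sumℚ (λ i → L (ψ i) i) ≡ ℕ→ℚ n - 1ℚ
  sum-L-grounded = begin
    sumℚ (λ i → L (ψ i) i)                 ≡⟨ sum-cong (λ i → L-pot i g i) ⟩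
    sumℚ (λ i → δ G i i - δ G g i)         ≡⟨ sum-- (λ i → δ G i i) (λ i → δ G g i) ⟩
    sumℚ (λ i → δ G i i) - sumℚ (δ G g)    ≡⟨ cong₂ _-_ (trans (sum-cong (δ-same G)) (sum-const n 1ℚ))
                                                          (trans (sum-cong (δG≡δ' G g)) (sum-δ' g)) ⟩
    ℕ→ℚ n * 1ℚ - 1ℚ                        ≡⟨ cong (_- 1ℚ) (*-identityʳ (ℕ→ℚ n)) ⟩
    ℕ→ℚ n - 1ℚ ∎

  -- Each edge ij contributes the current of ψ i at i and that of ψ j at j, so the
  -- arc sum of grounded resistances is twice the trace Σᵢ (L (ψ i))ᵢ = n - 1.
  arcSum-grounded : arcSum (grounded g) ≡ (ℕ→ℚ n - 1ℚ) + (ℕ→ℚ n - 1ℚ)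
  arcSum-grounded = begin
    arcSum (grounded g)  ≡⟨ sum-cong (λ i → sum-cong (λ j → pw i j)) ⟩
    sumℚ (λ i → sumℚ (λ j → current (ψ i) i j + current (ψ j) j i))
      ≡⟨ sum-cong (λ i → sum-+ (λ j → current (ψ i) i j) (λ j → current (ψ j) j i)) ⟩
    sumℚ (λ i → L (ψ i) i + sumℚ (λ j → current (ψ j) j i))
      ≡⟨ sum-+ (λ i → L (ψ i) i) (λ i → sumℚ (λ j → current (ψ j) j i)) ⟩
    sumℚ (λ i → L (ψ i) i) + sumℚ (λ i → sumℚ (λ j → current (ψ j) j i))
      ≡⟨ cong (sumℚ (λ i → L (ψ i) i) +_) (sum-swap (λ i j → current (ψ j) j i)) ⟩
    sumℚ (λ i → L (ψ i) i) + sumℚ (λ j → L (ψ j) j)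
      ≡⟨ cong₂ _+_ sum-L-grounded sum-L-grounded ⟩
    (ℕ→ℚ n - 1ℚ) + (ℕ→ℚ n - 1ℚ) ∎
    where
      pw : ∀ i j → (if adj G i j then grounded g i j else 0ℚ) ≡ current (ψ i) i j + current (ψ j) j i
      pw i j rewrite gsym G j i with adj G i j
      ... | true = solve 4 (λ a b c d → a :- b :- c :+ d := (a :- c) :+ (d :- b)) refl (pot i g i) (pot j g i) (pot i g j) (pot j g j)
      ... | false = sym (+-identityˡ 0ℚ)

  double-cancel : ∀ {x y} → x + x ≡ y + y → x ≡ y
  double-cancel {x} {y} e = mul-cancelˡ-≡ {c = 1ℚ + 1ℚ} (λ ()) (begin
      (1ℚ + 1ℚ) * x ≡⟨ solve 1 (λ x → (con 1ℚ :+ con 1ℚ) :* x := x :+ x) refl x ⟩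
      x + x ≡⟨ e ⟩
      y + y ≡⟨ solve 1 (λ x → x :+ x := (con 1ℚ :+ con 1ℚ) :* x) refl y ⟩
      (1ℚ + 1ℚ) * y ∎)

  foster : edgeSum Ω ≡ ℕ→ℚ n - 1ℚ
  foster = trans (edgeSum-cong Ω (grounded g) (λ i j _ → Ω≡grounded g i j)) (double-cancel (trans (edgeSum-twice (grounded g) (grounded-sym g)) arcSum-grounded))

lagrange-term-expand : ∀ x y p q → x * p ≡ 1ℚ → y * q ≡ 1ℚ →
         (x - y) * (x - y) * (p * q) ≡ x * q + y * p - (1ℚ + 1ℚ)
lagrange-term-expand x y p q e1 e2 = begin
   (x - y) * (x - y) * (p * q)
     ≡⟨ solve 4 (λ x y p q → (x :- y) :* (x :- y) :* (p :* q) := x :* q :* (x :* p) :+ y :* p :* (y :* q) :- (con 1ℚ :+ con 1ℚ) :* ((x :* p) :* (y :* q))) refl x y p q ⟩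
   x * q * (x * p) + y * p * (y * q) - (1ℚ + 1ℚ) * ((x * p) * (y * q))
     ≡⟨ cong₂ (λ a b → x * q * a + y * p * b - (1ℚ + 1ℚ) * (a * b)) e1 e2 ⟩
   x * q * 1ℚ + y * p * 1ℚ - (1ℚ + 1ℚ) * (1ℚ * 1ℚ)
     ≡⟨ solve 4 (λ x y p q → x :* q :* con 1ℚ :+ y :* p :* con 1ℚ :- (con 1ℚ :+ con 1ℚ) :* (con 1ℚ :* con 1ℚ) := x :* q :+ y :* p :- (con 1ℚ :+ con 1ℚ)) refl x y p q ⟩
   x * q + y * p - (1ℚ + 1ℚ) ∎

module CauchySchwarz {n : ℕ} (G : Graph n) (conn : Connected G) (Ω : Fin n → Fin n → ℚ)
                     (H : IsEffectiveResistance G Ω) where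
  open Resistance G conn Ω H
  open EdgeSum G

  inv : Fin n → Fin n → ℚ
  inv i j = invℚ (Ω i j)

  S1 S2 m : ℚ
  S1 = edgeSum Ω
  S2 = edgeSum inv
  m = edgeSum (λ _ _ → 1ℚ)

  lagrange-term : Fin n → Fin n → Fin n → Fin n → ℚ
  lagrange-term i j k l = (Ω i j - Ω k l) * (Ω i j - Ω k l) * (inv i j * inv k l)

  lagrange-row : Fin n → Fin n → ℚ
  lagrange-row i j = edgeSum (lagrange-term i j)

  lagrange-row≡ : ∀ i j → Adj G i j → lagrange-row i j ≡ Ω i j * S2 + inv i j * S1 - (1ℚ + 1ℚ) * m
  lagrange-row≡ i j a = trans (edgeSum-cong (lagrange-term i j) (λ k l → Ω i j * inv k l + inv i j * Ω k l - (1ℚ + 1ℚ) * 1ℚ)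
                   (λ k l b → trans (lagrange-term-expand (Ω i j) (Ω k l) (inv i j) (inv k l) (invℚ-inverseʳ _ (Edge.Ω≢0 a)) (invℚ-inverseʳ _ (Edge.Ω≢0 b)))
                      (solve 5 (λ x y p q t → x :* q :+ y :* p :- t := x :* q :+ p :* y :- t :* con 1ℚ) refl (Ω i j) (Ω k l) (inv i j) (inv k l) (1ℚ + 1ℚ))))
                 (edgeSum-linear₃ (Ω i j) (inv i j) (1ℚ + 1ℚ) inv Ω (λ _ _ → 1ℚ))

  -- Lagrange's identity, with Σ over pairs of edges e, f of (Ω e - Ω f)² / (Ω e Ω f).
  lagrange-identity : edgeSum lagrange-row ≡ (1ℚ + 1ℚ) * (S1 * S2 - m * m)
  lagrange-identity = trans (edgeSum-cong lagrange-row (λ i j → S2 * Ω i j + S1 * inv i j - ((1ℚ + 1ℚ) * m) * 1ℚ)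
           (λ i j a → trans (lagrange-row≡ i j a) (solve 5 (λ x p s1 s2 t → x :* s2 :+ p :* s1 :- t := s2 :* x :+ s1 :* p :- t :* con 1ℚ) refl (Ω i j) (inv i j) S1 S2 ((1ℚ + 1ℚ) * m))))
        (trans (edgeSum-linear₃ S2 S1 ((1ℚ + 1ℚ) * m) Ω inv (λ _ _ → 1ℚ))
          (solve 3 (λ s1 s2 m → s2 :* s1 :+ s1 :* s2 :- ((con 1ℚ :+ con 1ℚ) :* m) :* m := (con 1ℚ :+ con 1ℚ) :* (s1 :* s2 :- m :* m)) refl S1 S2 m))

  lagrange-term-nonneg : ∀ i j k l → Adj G i j → Adj G k l → 0ℚ ≤ lagrange-term i j k l
  lagrange-term-nonneg i j k l a b = nonNeg*nonNeg (0≤p*p (Ω i j - Ω k l)) (<⇒≤ (pos*pos (invℚ-pos _ (Edge.Ω-positive a)) (invℚ-pos _ (Edge.Ω-positive b))))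

  lagrange-row-nonneg : ∀ i j → Adj G i j → 0ℚ ≤ lagrange-row i j
  lagrange-row-nonneg i j a = edgeSum-nonneg (lagrange-term i j) (λ k l b → lagrange-term-nonneg i j k l a b)

  cauchy-schwarz : m * m ≤ S1 * S2
  cauchy-schwarz = 0≤q-p⇒p≤q (mul-cancelˡ-≤ {c = 1ℚ + 1ℚ} (*<* (ℤ.+<+ (ℕ.s≤s ℕ.z≤n)))
              (subst₂ _≤_ (sym (*-zeroʳ (1ℚ + 1ℚ))) lagrange-identity (edgeSum-nonneg lagrange-row lagrange-row-nonneg)))

  two≢0 : ¬ (1ℚ + 1ℚ) ≡ 0ℚ
  two≢0 ()

  cauchy-schwarz-equality⇒ : m * m ≡ S1 * S2 → ∀ i j k l → isEdge< G i j ≡ true → isEdge< G k l ≡ true → Ω i j ≡ Ω k l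
  cauchy-schwarz-equality⇒ e i j k l eij ekl = p-q≡0⇒p≡q (p*p≡0⇒p≡0 _ (p*q≡0⇒p≡0 (pos*pos (invℚ-pos _ (Edge.Ω-positive aij)) (invℚ-pos _ (Edge.Ω-positive akl))) qz))
    where
      aij : Adj G i j
      aij = isEdge⇒adj i j eij
      akl : Adj G k l
      akl = isEdge⇒adj k l ekl
      Q0 : edgeSum lagrange-row ≡ 0ℚ
      Q0 = trans lagrange-identity (trans (cong ((1ℚ + 1ℚ) *_) (p≡q⇒p-q≡0 (sym e))) (*-zeroʳ (1ℚ + 1ℚ)))
      in0 : lagrange-row i j ≡ 0ℚ
      in0 = edgeSum≡0⇒zero lagrange-row lagrange-row-nonneg Q0 i j eij
      qz : lagrange-term i j k l ≡ 0ℚ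
      qz = edgeSum≡0⇒zero (lagrange-term i j) (λ k' l' b → lagrange-term-nonneg i j k' l' aij b) in0 k l ekl

  cauchy-schwarz-equality⇐ : (∀ i j k l → Adj G i j → Adj G k l → Ω i j ≡ Ω k l) → m * m ≡ S1 * S2
  cauchy-schwarz-equality⇐ h = sym (p-q≡0⇒p≡q (mul-cancelˡ-≡ {c = 1ℚ + 1ℚ} two≢0 (trans (sym lagrange-identity) (trans Q0 (sym (*-zeroʳ (1ℚ + 1ℚ)))))))
    where
      Q0 : edgeSum lagrange-row ≡ 0ℚ
      Q0 = trans (edgeSum-cong lagrange-row (λ _ _ → 0ℚ) (λ i j a →
              trans (edgeSum-cong (lagrange-term i j) (λ _ _ → 0ℚ) (λ k l b →
                 trans (cong (λ z → (Ω i j - z) * (Ω i j - z) * (inv i j * inv k l)) (sym (h i j k l a b)))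
                   (trans (cong (λ z → z * z * (inv i j * inv k l)) (+-inverseʳ (Ω i j))) (trans (cong (_* (inv i j * inv k l)) (*-zeroˡ 0ℚ)) (*-zeroˡ (inv i j * inv k l))))))
                edgeSum-0)) edgeSum-0

-- The upper bound

½ : ℚ
½ = ℤ.+ 1 ℚ./ 2

two*½≡1 : two * ½ ≡ 1ℚ
two*½≡1 = refl

0≤two : 0ℚ ≤ two
0≤two = <⇒≤ 0<two

b2q : ∀ {A : Set} → Dec A → ℚ
b2q (yes _) = 1ℚ
b2q (no _) = 0ℚ

b2q-yes : ∀ {A : Set} (d : Dec A) → A → b2q d ≡ 1ℚ
b2q-yes (yes _) _ = refl
b2q-yes (no na) a = ⊥-elim (na a)

b2q-no : ∀ {A : Set} (d : Dec A) → ¬ A → b2q d ≡ 0ℚ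
b2q-no (yes a) na = ⊥-elim (na a)
b2q-no (no _) _ = refl

-- With D = n - 2 and N = n: the chord bound is the piecewise linear interpolant of 1/x at the
-- nodes 2/N, Y/N and 1; as 1/x is convex it dominates 1/x on [2/N, 1], with equality only at the nodes.
module ChordBound (D ε : ℚ) (Dpos : 0ℚ < D) (ε0 : 0ℚ ≤ ε) (ε1 : ε < 1ℚ) where
  N Y iY : ℚ
  N = D + two
  Y = D * ε + two
  iY = invℚ Y

  Ypos : 0ℚ < Y
  Ypos = subst (_< Y) (+-identityˡ 0ℚ) (+-mono-≤-< (nonNeg*nonNeg (<⇒≤ Dpos) ε0) 0<two)

  YiY : Y * iY ≡ 1ℚ
  YiY = invℚ-inverseʳ Y (λ e → <-irrefl (sym e) Ypos)

  lowGap highGap : ℚ → ℚ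
  lowGap x = (Y - N * x) ⊔ 0ℚ
  highGap x = (N * x - Y) ⊔ 0ℚ

  chord : ℚ → ℚ
  chord x = 1ℚ + (1ℚ - x) * N * iY + D * lowGap x * iY * ½

  chord-cleared : ℚ → ℚ
  chord-cleared x = two * x * Y + two * x * (1ℚ - x) * N + D * x * lowGap x

  chord-cleared≡ : ∀ x → (two * x * Y) * chord x ≡ chord-cleared x
  chord-cleared≡ x = begin
      (two * x * Y) * chord x
        ≡⟨ solve 8 (λ t x y iy n d z h → (t :* x :* y) :* (con 1ℚ :+ (con 1ℚ :- x) :* n :* iy :+ d :* z :* iy :* h)
                        := t :* x :* y :+ t :* x :* (con 1ℚ :- x) :* n :* (y :* iy) :+ d :* x :* z :* (y :* iy) :* (t :* h))
               refl two x Y iY N D (lowGap x) ½ ⟩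
      two * x * Y + two * x * (1ℚ - x) * N * (Y * iY) + D * x * lowGap x * (Y * iY) * (two * ½)
        ≡⟨ cong (λ w → two * x * Y + two * x * (1ℚ - x) * N * w + D * x * lowGap x * w * (two * ½)) YiY ⟩
      two * x * Y + two * x * (1ℚ - x) * N * 1ℚ + D * x * lowGap x * 1ℚ * 1ℚ
        ≡⟨ solve 6 (λ t x y n d z → t :* x :* y :+ t :* x :* (con 1ℚ :- x) :* n :* con 1ℚ :+ d :* x :* z :* con 1ℚ :* con 1ℚ
                          := t :* x :* y :+ t :* x :* (con 1ℚ :- x) :* n :+ d :* x :* z) refl two x Y N D (lowGap x) ⟩
      chord-cleared x ∎

  inv-cleared≡ : ∀ x → ¬ x ≡ 0ℚ → (two * x * Y) * invℚ x ≡ two * Y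
  inv-cleared≡ x nz = begin
      (two * x * Y) * invℚ x  ≡⟨ solve 4 (λ t x y i → t :* x :* y :* i := t :* y :* (x :* i)) refl two x Y (invℚ x) ⟩
      two * Y * (x * invℚ x)  ≡⟨ cong (two * Y *_) (invℚ-inverseʳ x nz) ⟩
      two * Y * 1ℚ            ≡⟨ *-identityʳ (two * Y) ⟩
      two * Y ∎

  lowGap-high : ∀ x → Y - N * x ≤ 0ℚ → lowGap x ≡ 0ℚ
  lowGap-high x le = p≤q⇒p⊔q≡q le

  lowGap-low : ∀ x → 0ℚ ≤ Y - N * x → lowGap x ≡ Y - N * x
  lowGap-low x ge = p≥q⇒p⊔q≡p ge

  chord-gap-high : ∀ x → Y - N * x ≤ 0ℚ → chord-cleared x - two * Y ≡ two * (1ℚ - x) * (N * x - Y)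
  chord-gap-high x le rewrite lowGap-high x le =
    solve 5 (λ t x y n d → t :* x :* y :+ t :* x :* (con 1ℚ :- x) :* n :+ d :* x :* con 0ℚ :- t :* y
                   := t :* (con 1ℚ :- x) :* (n :* x :- y)) refl two x Y N D

  chord-gap-low : ∀ x → 0ℚ ≤ Y - N * x → chord-cleared x - two * Y ≡ (N * x - two) * (Y - N * x)
  chord-gap-low x ge rewrite lowGap-low x ge =
    solve 4 (λ t x y d → t :* x :* y :+ t :* x :* (con 1ℚ :- x) :* (d :+ t) :+ d :* x :* (y :- (d :+ t) :* x) :- t :* y
                   := ((d :+ t) :* x :- t) :* (y :- (d :+ t) :* x)) refl two x Y D

  chord-gap-nonneg : ∀ x → two ≤ N * x → x ≤ 1ℚ → two * Y ≤ chord-cleared x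
  chord-gap-nonneg x lo hi with ≤-total (Y - N * x) 0ℚ
  ... | inj₁ le = ≤-via-difference _ (chord-gap-high x le) (nonNeg*nonNeg (nonNeg*nonNeg 0≤two (p≤q⇒0≤q-p hi)) (subst (0ℚ ≤_) (solve 2 (λ y nx → con 0ℚ :- (y :- nx) := nx :- y) refl Y (N * x)) (p≤q⇒0≤q-p le)))
  ... | inj₂ ge = ≤-via-difference _ (chord-gap-low x ge) (nonNeg*nonNeg (p≤q⇒0≤q-p lo) ge)

  inv≤chord : ∀ x → 0ℚ < x → two ≤ N * x → x ≤ 1ℚ → invℚ x ≤ chord x
  inv≤chord x xp lo hi = mul-cancelˡ-≤ {c = two * x * Y} (pos*pos (pos*pos 0<two xp) Ypos)
    (subst₂ _≤_ (sym (inv-cleared≡ x (λ e → <-irrefl (sym e) xp))) (sym (chord-cleared≡ x)) (chord-gap-nonneg x lo hi))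

  inv≡chord⇒gap≡0 : ∀ x → 0ℚ < x → invℚ x ≡ chord x → chord-cleared x - two * Y ≡ 0ℚ
  inv≡chord⇒gap≡0 x xp e = p≡q⇒p-q≡0 (trans (sym (chord-cleared≡ x)) (trans (cong (two * x * Y *_) (sym e)) (inv-cleared≡ x (λ e → <-irrefl (sym e) xp))))

  inv≡chord⇒node : ∀ x → 0ℚ < x → invℚ x ≡ chord x → (N * x ≡ two ⊎ N * x ≡ Y) ⊎ x ≡ 1ℚ
  inv≡chord⇒node x xp e = h (≤-total (Y - N * x) 0ℚ)
    where
      d0 : chord-cleared x - two * Y ≡ 0ℚ
      d0 = inv≡chord⇒gap≡0 x xp e
      h : (Y - N * x ≤ 0ℚ) ⊎ (0ℚ ≤ Y - N * x) → (N * x ≡ two ⊎ N * x ≡ Y) ⊎ x ≡ 1ℚ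
      h (inj₁ le) = h1 (p*q≡0⇒p≡0⊎q≡0 (two * (1ℚ - x)) (N * x - Y) (trans (sym (chord-gap-high x le)) d0))
        where
          h1 : (two * (1ℚ - x) ≡ 0ℚ) ⊎ (N * x - Y ≡ 0ℚ) → (N * x ≡ two ⊎ N * x ≡ Y) ⊎ x ≡ 1ℚ
          h1 (inj₂ z) = inj₁ (inj₂ (p-q≡0⇒p≡q z))
          h1 (inj₁ z) = h2' (p*q≡0⇒p≡0⊎q≡0 two (1ℚ - x) z)
            where
              h2' : (two ≡ 0ℚ) ⊎ (1ℚ - x ≡ 0ℚ) → (N * x ≡ two ⊎ N * x ≡ Y) ⊎ x ≡ 1ℚ
              h2' (inj₁ z2) = ⊥-elim (<-irrefl (sym z2) 0<two)
              h2' (inj₂ z2) = inj₂ (sym (p-q≡0⇒p≡q z2))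
      h (inj₂ ge) = h1 (p*q≡0⇒p≡0⊎q≡0 (N * x - two) (Y - N * x) (trans (sym (chord-gap-low x ge)) d0))
        where
          h1 : (N * x - two ≡ 0ℚ) ⊎ (Y - N * x ≡ 0ℚ) → (N * x ≡ two ⊎ N * x ≡ Y) ⊎ x ≡ 1ℚ
          h1 (inj₁ z) = inj₁ (inj₁ (p-q≡0⇒p≡q z))
          h1 (inj₂ z) = inj₁ (inj₂ (sym (p-q≡0⇒p≡q z)))

  isHigh : ℚ → ℚ
  isHigh x = b2q (Y <? N * x)

  Npos : 0ℚ < N
  Npos = subst (_< N) (+-identityˡ 0ℚ) (+-mono-<-≤ Dpos 0≤two)

  lowGap≤ : ∀ x → two ≤ N * x → lowGap x ≤ (1ℚ - isHigh x) * (Y - two)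
  lowGap≤ x lo with Y <? N * x
  ... | yes lt = subst₂ _≤_ (sym (lowGap-high x (<⇒≤ (p<q⇒p-q<0 lt)))) (sym (trans (cong (_* (Y - two)) (+-inverseʳ 1ℚ)) (*-zeroˡ (Y - two)))) ≤-refl
  ... | no nlt = subst₂ _≤_ (sym (lowGap-low x (p≤q⇒0≤q-p (≮⇒≥ nlt)))) (solve 2 (λ y t → y :- t := (con 1ℚ :- con 0ℚ) :* (y :- t)) refl Y two)
                   (+-mono-≤ (≤-refl {Y}) (neg-antimono-≤ lo))

  highGap-low : ∀ x → N * x - Y ≤ 0ℚ → highGap x ≡ 0ℚ
  highGap-low x le = p≤q⇒p⊔q≡q le

  highGap-high : ∀ x → 0ℚ ≤ N * x - Y → highGap x ≡ N * x - Y
  highGap-high x ge = p≥q⇒p⊔q≡p ge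

  highGap≤ : ∀ x → x ≤ 1ℚ → highGap x ≤ isHigh x * (N - Y)
  highGap≤ x hi with Y <? N * x
  ... | yes lt = subst₂ _≤_ (sym (highGap-high x (<⇒≤ (p<q⇒0<q-p lt)))) (sym (*-identityˡ (N - Y)))
                   (+-mono-≤ (subst (N * x ≤_) (*-identityʳ N) (mulˡ-≤ (<⇒≤ Npos) hi)) (≤-refl { - Y}))
  ... | no nlt = subst₂ _≤_ (sym (highGap-low x (subst (_≤ 0ℚ) (neg-difference Y (N * x)) (neg-antimono-≤ (p≤q⇒0≤q-p (≮⇒≥ nlt))))))
                   (sym (*-zeroˡ (N - Y))) ≤-refl

  lowGap-highGap : ∀ x → lowGap x - highGap x ≡ Y - N * x
  lowGap-highGap x = h (≤-total (Y - N * x) 0ℚ)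
    where
      h : (Y - N * x ≤ 0ℚ) ⊎ (0ℚ ≤ Y - N * x) → lowGap x - highGap x ≡ Y - N * x
      h (inj₁ le) = trans (cong₂ _-_ (lowGap-high x le) (highGap-high x (subst (0ℚ ≤_) (neg-difference Y (N * x)) (neg-antimono-≤ le))))
                      (solve 2 (λ y nx → con 0ℚ :- (nx :- y) := y :- nx) refl Y (N * x))
      h (inj₂ ge) = trans (cong₂ _-_ (lowGap-low x ge) (highGap-low x (subst (_≤ 0ℚ) (neg-difference Y (N * x)) (neg-antimono-≤ ge))))
                      (solve 1 (λ a → a :- con 0ℚ := a) refl (Y - N * x))

module UpperBound {n : ℕ} (G : Graph n) (conn : Connected G) (Ω : Fin n → Fin n → ℚ)
         (H : IsEffectiveResistance G Ω) (g : Fin n)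
         (D ε : ℚ) (Dpos : 0ℚ < D) (ε0 : 0ℚ ≤ ε) (ε1 : ε < 1ℚ)
         (eND : ℕ→ℚ n ≡ D + two) (k : ℤ) where
  open Laplacian G
  open Resistance G conn Ω H
  open EdgeSum G
  open Foster G conn Ω H g
  open CauchySchwarz G conn Ω H
  open ChordBound D ε Dpos ε0 ε1

  kq : ℚ
  kq = ℤ→ℚ k

  -- rel is the defining equation q (n - 2) = n² - n - 2m of q = ⌊q⌋ + ε.
  module Quotient (rel : (kq + ε) * D ≡ N * N - N - two * m) where

    S1≡N-1 : S1 ≡ N - 1ℚ
    S1≡N-1 = trans foster (cong (_- 1ℚ) eND)

    2≤NΩ : ∀ i j → Adj G i j → two ≤ N * Ω i j
    2≤NΩ i j a = subst (λ z → two ≤ z * Ω i j) eND (Edge.2≤nΩ a)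

    edgeSum-bound : edgeSum (λ i j → chord (Ω i j)) ≡ m + (m - S1) * N * iY + D * iY * ½ * edgeSum (λ i j → lowGap (Ω i j))
    edgeSum-bound = trans (edgeSum-cong (λ i j → chord (Ω i j)) (λ i j → 1ℚ * 1ℚ + (N * iY) * 1ℚ - (N * iY) * Ω i j + (D * iY * ½) * lowGap (Ω i j))
               (λ i j _ → solve 6 (λ x n iy d z h → con 1ℚ :+ (con 1ℚ :- x) :* n :* iy :+ d :* z :* iy :* h
                                      := con 1ℚ :* con 1ℚ :+ (n :* iy) :* con 1ℚ :- (n :* iy) :* x :+ (d :* iy :* h) :* z) refl (Ω i j) N iY D (lowGap (Ω i j)) ½))
             (trans (edgeSum-linear₄ 1ℚ (N * iY) (N * iY) (D * iY * ½) (λ _ _ → 1ℚ) (λ _ _ → 1ℚ) Ω (λ i j → lowGap (Ω i j)))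
               (solve 7 (λ m s1 n iy d h z → con 1ℚ :* m :+ (n :* iy) :* m :- (n :* iy) :* s1 :+ (d :* iy :* h) :* z
                                   := m :+ (m :- s1) :* n :* iy :+ d :* iy :* h :* z) refl m S1 N iY D ½ (edgeSum (λ i j → lowGap (Ω i j)))))

    S2≤Σchord : S2 ≤ edgeSum (λ i j → chord (Ω i j))
    S2≤Σchord = edgeSum-mono inv (λ i j → chord (Ω i j)) (λ i j a → inv≤chord (Ω i j) (Edge.Ω-positive a) (2≤NΩ i j a) (Edge.Ω≤1 a))

    #high : ℕ
    #high = sumℕ λ i → sumℕ λ j → if isEdge< G i j then b2n (Y <? N * Ω i j) else 0

    highCount : ℚ
    highCount = edgeSum (λ i j → isHigh (Ω i j))

    highCount≡#high : highCount ≡ ℕ→ℚ #high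
    highCount≡#high = sym (trans (ℕ→ℚ-sumℕ (λ i → sumℕ λ j → if isEdge< G i j then b2n (Y <? N * Ω i j) else 0))
              (sum-cong λ i → trans (ℕ→ℚ-sumℕ (λ j → if isEdge< G i j then b2n (Y <? N * Ω i j) else 0))
                (sum-cong λ j → pw (isEdge< G i j) (Y <? N * Ω i j))))
      where
        pw : ∀ b {A : Set} (d : Dec A) → ℕ→ℚ (if b then b2n d else 0) ≡ (if b then b2q d else 0ℚ)
        pw true (yes _) = refl
        pw true (no _) = refl
        pw false d = refl

    Z : Fin n → Fin n → ℚ
    Z i j = lowGap (Ω i j)
    W : Fin n → Fin n → ℚ
    W i j = highGap (Ω i j)

    Σlow≤ : edgeSum Z ≤ (Y - two) * (m - highCount)
    Σlow≤ = subst (edgeSum Z ≤_) (edgeSum-1- (Y - two) (λ i j → isHigh (Ω i j)))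
      (edgeSum-mono Z (λ i j → (Y - two) * 1ℚ - (Y - two) * isHigh (Ω i j))
        (λ i j a → subst (Z i j ≤_) (solve 2 (λ b c → (con 1ℚ :- b) :* c := c :* con 1ℚ :- c :* b) refl (isHigh (Ω i j)) (Y - two))
                     (lowGap≤ (Ω i j) (2≤NΩ i j a))))

    Σhigh≤ : edgeSum W ≤ (N - Y) * highCount
    Σhigh≤ = subst (edgeSum W ≤_) (edgeSum-*ˡ (N - Y) (λ i j → isHigh (Ω i j)))
      (edgeSum-mono W (λ i j → (N - Y) * isHigh (Ω i j))
        (λ i j a → subst (W i j ≤_) (*-comm (isHigh (Ω i j)) (N - Y)) (highGap≤ (Ω i j) (Edge.Ω≤1 a))))

    Σlow-Σhigh : edgeSum Z - edgeSum W ≡ Y * m - N * S1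
    Σlow-Σhigh = trans (sym (edgeSum-- Z W))
               (trans (edgeSum-cong (λ i j → Z i j - W i j) (λ i j → Y * 1ℚ - N * Ω i j) (λ i j _ → trans (lowGap-highGap (Ω i j)) (cong (_- N * Ω i j) (sym (*-identityʳ Y)))))
                 (trans (edgeSum-- (λ i j → Y * 1ℚ) (λ i j → N * Ω i j)) (cong₂ _-_ (edgeSum-*ˡ Y (λ _ _ → 1ℚ)) (edgeSum-*ˡ N Ω))))

    Σlow≤′ : edgeSum Z ≤ Y * m - N * S1 + (N - Y) * highCount
    Σlow≤′ = subst (_≤ Y * m - N * S1 + (N - Y) * highCount)
                 (solve 2 (λ z w → (z :- w) :+ w := z) refl (edgeSum Z) (edgeSum W))
                 (+-mono-≤ (≤-reflexive Σlow-Σhigh) Σhigh≤)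

    R0≡0 : (kq + ε) * D - (N * N - N - two * m) ≡ 0ℚ
    R0≡0 = p≡q⇒p-q≡0 rel

    -- The number of high edges is an integer, hence either ≤ ⌊q⌋ or ≥ ⌊q⌋ + 1.  In the first case use
    -- Σ low = Σ high + Y m - N (N - 1) (Foster); in the second, low ≤ Y - 2 vanishes on high edges.
    Σlow-bound : edgeSum Z ≤ D * ε * (m - kq - 1ℚ)
    Σlow-bound with ℤ.+ #high ℤP.≤? k
    ... | yes p = ≤-trans Σlow≤′ (≤-via-difference (D * (1ℚ - ε) * (kq - highCount))
            (trans (cong (λ s → D * ε * (m - kq - 1ℚ) - (Y * m - N * s + (N - Y) * highCount)) S1≡N-1)
              (trans (solve 6 (λ d e t m k p →
                         d :* e :* (m :- k :- con 1ℚ) :- ((d :* e :+ t) :* m :- (d :+ t) :* ((d :+ t) :- con 1ℚ) :+ ((d :+ t) :- (d :* e :+ t)) :* p)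
                         := d :* (con 1ℚ :- e) :* (k :- p) :- ((k :+ e) :* d :- ((d :+ t) :* (d :+ t) :- (d :+ t) :- t :* m)))
                       refl D ε two m kq highCount)
                 (trans (cong (λ a → D * (1ℚ - ε) * (kq - highCount) - a) R0≡0) (solve 1 (λ a → a :- con 0ℚ := a) refl (D * (1ℚ - ε) * (kq - highCount))))))
            (nonNeg*nonNeg (nonNeg*nonNeg (<⇒≤ Dpos) (p≤q⇒0≤q-p (<⇒≤ ε1))) (p≤q⇒0≤q-p Pk)))
      where
        Pk : highCount ≤ kq
        Pk = subst (_≤ kq) (sym highCount≡#high) (ℤ→ℚ-mono-≤ p)
    ... | no np = ≤-trans Σlow≤ (≤-via-difference (D * ε * (highCount - (1ℚ + kq)))
            (solve 6 (λ d e t m k p → d :* e :* (m :- k :- con 1ℚ) :- ((d :* e :+ t) :- t) :* (m :- p)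
                                      := d :* e :* (p :- (con 1ℚ :+ k))) refl D ε two m kq highCount)
            (nonNeg*nonNeg (nonNeg*nonNeg (<⇒≤ Dpos) ε0) (p≤q⇒0≤q-p kP)))
      where
        kP : 1ℚ + kq ≤ highCount
        kP = subst₂ _≤_ (ℤ→ℚ-+ (ℤ.+ 1) k) (sym highCount≡#high) (ℤ→ℚ-mono-≤ (ℤP.i<j⇒suc[i]≤j (ℤP.≰⇒> np)))

    upper+m chord-total : ℚ
    upper+m = N * iY + (m * N - N * N + D * ε) * ½ + m
    chord-total = m + (m - S1) * N * iY + D * iY * ½ * (D * ε * (m - kq - 1ℚ))

    Σchord≤chord-total : edgeSum (λ i j → chord (Ω i j)) ≤ chord-total
    Σchord≤chord-total = subst (_≤ chord-total) (sym edgeSum-bound)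
      (+-mono-≤ (≤-refl {m + (m - S1) * N * iY}) (mulˡ-≤ c-nn Σlow-bound))
      where
        c-nn : 0ℚ ≤ D * iY * ½
        c-nn = nonNeg*nonNeg (nonNeg*nonNeg (<⇒≤ Dpos) (<⇒≤ (invℚ-pos Y Ypos))) (*≤* (ℤ.+≤+ ℕ.z≤n))

    A B Q0 R0 : ℚ
    A = (m - (N - 1ℚ)) * N + D * D * ε * (m - kq - 1ℚ) * ½ - N
    B = - ((m * N - N * N + D * ε) * ½)
    Q0 = D * m + m * two - D * D - (1ℚ + 1ℚ) * D * two + - (two * two)
    R0 = (kq + ε) * D - (N * N - N - two * m)

    chord-total≡upper+m : chord-total ≡ upper+m
    chord-total≡upper+m = p-q≡0⇒p≡q (begin
      chord-total - upper+m
        ≡⟨ cong (λ s → m + (m - s) * N * iY + D * iY * ½ * (D * ε * (m - kq - 1ℚ)) - upper+m) S1≡N-1 ⟩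
      m + (m - (N - 1ℚ)) * N * iY + D * iY * ½ * (D * ε * (m - kq - 1ℚ)) - upper+m
        ≡⟨ solve 8 (λ m n iy d h e k y →
              m :+ (m :- (n :- con 1ℚ)) :* n :* iy :+ d :* iy :* h :* (d :* e :* (m :- k :- con 1ℚ)) :- (n :* iy :+ (m :* n :- n :* n :+ d :* e) :* h :+ m)
              := ((m :- (n :- con 1ℚ)) :* n :+ d :* d :* e :* (m :- k :- con 1ℚ) :* h :- n) :* iy :+ (:- ((m :* n :- n :* n :+ d :* e) :* h)) :* con 1ℚ)
              refl m N iY D ½ ε kq Y ⟩
      A * iY + B * 1ℚ
        ≡⟨ cong (λ w → A * iY + B * w) (sym YiY) ⟩
      A * iY + B * (Y * iY)
        ≡⟨ solve 4 (λ a b y iy → a :* iy :+ b :* (y :* iy) := iy :* (a :+ b :* y)) refl A B Y iY ⟩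
      iY * (A + B * Y)
        ≡⟨ cong (iY *_) (solve 6 (λ m d e k h t →
               ((m :- ((d :+ t) :- con 1ℚ)) :* (d :+ t) :+ d :* d :* e :* (m :- k :- con 1ℚ) :* h :- (d :+ t))
                :+ (:- ((m :* (d :+ t) :- (d :+ t) :* (d :+ t) :+ d :* e) :* h)) :* (d :* e :+ t)
               := :- (e :* d :* h) :* ((k :+ e) :* d :- ((d :+ t) :* (d :+ t) :- (d :+ t) :- t :* m))
                  :+ (con 1ℚ :- t :* h) :* (d :* m :+ m :* t :- d :* d :- (con 1ℚ :+ con 1ℚ) :* d :* t :+ :- (t :* t)))
               refl m D ε kq ½ two) ⟩
      iY * (- (ε * D * ½) * R0 + (1ℚ - two * ½) * Q0)
        ≡⟨ cong₂ (λ r w → iY * (- (ε * D * ½) * r + (1ℚ - w) * Q0)) R0≡0 two*½≡1 ⟩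
      iY * (- (ε * D * ½) * 0ℚ + (1ℚ - 1ℚ) * Q0)
        ≡⟨ solve 3 (λ iy c q → iy :* (:- c :* con 0ℚ :+ (con 1ℚ :- con 1ℚ) :* q) := con 0ℚ) refl iY (ε * D * ½) Q0 ⟩
      0ℚ ∎)

    S2≤upper+m : S2 ≤ upper+m
    S2≤upper+m = subst (S2 ≤_) chord-total≡upper+m (≤-trans S2≤Σchord Σchord≤chord-total)

module CompleteGraph {n : ℕ} (G : Graph n) (conn : Connected G) (Ω : Fin n → Fin n → ℚ)
                     (H : IsEffectiveResistance G Ω) (comp : IsComplete G) where
  open Laplacian G
  open Resistance G conn Ω H

  N : ℚ
  N = ℕ→ℚ n

  module _ (Npos : 0ℚ < N) {u v : Fin n} (uv : ¬ u ≡ v) where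
    iN : ℚ
    iN = invℚ N

    NiN : N * iN ≡ 1ℚ
    NiN = invℚ-inverseʳ N (λ e → <-irrefl (sym e) Npos)

    -- In Kₙ, (Lφ)ₖ = n φₖ - Σ φ, so φ = (eᵤ - eᵥ)/n solves Kirchhoff's equations.
    φ : Fin n → ℚ
    φ x = (δ' u x - δ' v x) * iN

    sumφ : sumℚ φ ≡ 0ℚ
    sumφ = trans (sum-*ʳ iN (λ x → δ' u x - δ' v x))
             (trans (cong (_* iN) (trans (sum-- (δ' u) (δ' v)) (cong₂ _-_ (sum-δ' u) (sum-δ' v))))
               (trans (cong (_* iN) (+-inverseʳ 1ℚ)) (*-zeroˡ iN)))

    Lφ : ∀ k → L φ k ≡ δ G u k - δ G v k
    Lφ k = begin
      L φ k ≡⟨ sum-cong {n} pw ⟩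
      sumℚ (λ j → φ k - φ j) ≡⟨ sum-- {n} (λ _ → φ k) φ ⟩
      sumℚ {n} (λ _ → φ k) - sumℚ φ ≡⟨ cong₂ _-_ (sum-const n (φ k)) sumφ ⟩
      N * φ k - 0ℚ ≡⟨ solve 4 (λ n a b i → n :* ((a :- b) :* i) :- con 0ℚ := (a :- b) :* (n :* i)) refl N (δ' u k) (δ' v k) iN ⟩
      (δ' u k - δ' v k) * (N * iN) ≡⟨ cong ((δ' u k - δ' v k) *_) NiN ⟩
      (δ' u k - δ' v k) * 1ℚ ≡⟨ *-identityʳ _ ⟩
      δ' u k - δ' v k ≡⟨ sym (cong₂ _-_ (δG≡δ' G u k) (δG≡δ' G v k)) ⟩
      δ G u k - δ G v k ∎
      where
        pw : ∀ j → current φ k j ≡ φ k - φ j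
        pw j with k FinP.≟ j
        ... | yes refl = trans (cong (λ c → if c then φ k - φ k else 0ℚ) (irrefl G k)) (sym (+-inverseʳ (φ k)))
        ... | no ne = cong (λ c → if c then φ k - φ j else 0ℚ) (comp k j ne)

    complete⇒nΩ≡2 : N * Ω u v ≡ two
    complete⇒nΩ≡2 = begin
      N * Ω u v ≡⟨ cong (N *_) (Ω≡pot-difference u v) ⟩
      N * (pot u v u - pot u v v) ≡⟨ cong (N *_) (solve 4 (λ a b c d → a :- b := (a :- c) :- (b :- d) :+ (c :- d)) refl (pot u v u) (pot u v v) (φ u) (φ v)) ⟩
      N * ((pot u v u - φ u) - (pot u v v - φ v) + (φ u - φ v))
        ≡⟨ cong (λ z → N * (z + (φ u - φ v))) (p≡q⇒p-q≡0 (equal-L⇒constant-difference (pot u v) φ (λ k → trans (L-pot u v k) (sym (Lφ k))) u v)) ⟩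
      N * (0ℚ + (φ u - φ v)) ≡⟨ cong (λ z → N * (0ℚ + (z - φ v))) (cong₂ (λ a b → (a - b) * iN) (δ'-same u) (δ'-diff (λ e → uv (sym e)))) ⟩
      N * (0ℚ + ((1ℚ - 0ℚ) * iN - φ v)) ≡⟨ cong (λ z → N * (0ℚ + ((1ℚ - 0ℚ) * iN - z))) (cong₂ (λ a b → (a - b) * iN) (δ'-diff uv) (δ'-same v)) ⟩
      N * (0ℚ + ((1ℚ - 0ℚ) * iN - (0ℚ - 1ℚ) * iN)) ≡⟨ solve 2 (λ n i → n :* (con 0ℚ :+ ((con 1ℚ :- con 0ℚ) :* i :- (con 0ℚ :- con 1ℚ) :* i)) := (con 1ℚ :+ con 1ℚ) :* (n :* i)) refl N iN ⟩
      (1ℚ + 1ℚ) * (N * iN) ≡⟨ cong ((1ℚ + 1ℚ) *_) NiN ⟩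
      (1ℚ + 1ℚ) * 1ℚ ≡⟨ refl ⟩
      two ∎

-- Equality in the upper bound

module UpperBoundEquality {n : ℕ} (G : Graph n) (conn : Connected G) (Ω : Fin n → Fin n → ℚ)
                          (H : IsEffectiveResistance G Ω) (g : Fin n)
                          (D ε : ℚ) (Dpos : 0ℚ < D) (ε0 : 0ℚ ≤ ε) (ε1 : ε < 1ℚ)
                          (eND : ℕ→ℚ n ≡ D + two) (k : ℤ) where
  open Laplacian G
  open Resistance G conn Ω H
  open EdgeSum G
  open Foster G conn Ω H g
  open CauchySchwarz G conn Ω H
  open ChordBound D ε Dpos ε0 ε1
  open UpperBound G conn Ω H g D ε Dpos ε0 ε1 eND k

  -- Equality forces 1/Ω = chord Ω on every edge, i.e. every edge sits at a node of the chord.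
  module Tight (rel : (kq + ε) * D ≡ N * N - N - two * m) (eqU : S2 ≡ Quotient.upper+m rel) where
    open Quotient rel

    Σchord≡chord-total : edgeSum (λ i j → chord (Ω i j)) ≡ chord-total
    Σchord≡chord-total = ≤-antisym Σchord≤chord-total
      (subst (_≤ edgeSum (λ i j → chord (Ω i j))) (trans eqU (sym chord-total≡upper+m)) S2≤Σchord)

    S2≡Σchord : S2 ≡ edgeSum (λ i j → chord (Ω i j))
    S2≡Σchord = trans eqU (trans (sym chord-total≡upper+m) (sym Σchord≡chord-total))

    inv≡chord : ∀ i j → isEdge< G i j ≡ true → inv i j ≡ chord (Ω i j)
    inv≡chord i j e = sym (p-q≡0⇒p≡q (edgeSum≡0⇒zero (λ i j → chord (Ω i j) - inv i j)
                     (λ i j a → p≤q⇒0≤q-p (inv≤chord (Ω i j) (Edge.Ω-positive a) (2≤NΩ i j a) (Edge.Ω≤1 a)))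
                     (trans (edgeSum-- (λ i j → chord (Ω i j)) inv) (p≡q⇒p-q≡0 (sym S2≡Σchord))) i j e))

    Σlow≡ : edgeSum Z ≡ D * ε * (m - kq - 1ℚ)
    Σlow≡ = mul-cancelˡ-≡ {c = D * iY * ½} (λ z → <-irrefl (sym z) cpos)
      (+-cancelˡ (m + (m - S1) * N * iY) (trans (sym edgeSum-bound) Σchord≡chord-total))
      where
        cpos : 0ℚ < D * iY * ½
        cpos = pos*pos (pos*pos Dpos (invℚ-pos Y Ypos)) (*<* (ℤ.+<+ (ℕ.s≤s ℕ.z≤n)))
        +-cancelˡ : ∀ a {b c} → a + b ≡ a + c → b ≡ c
        +-cancelˡ a {b} {c} e = trans (solve 2 (λ a b → b := a :+ b :- a) refl a b)
                                  (trans (cong (_- a) e) (solve 2 (λ a c → a :+ c :- a := c) refl a c))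

    edge-at-node< : ∀ i j → isEdge< G i j ≡ true → (N * Ω i j ≡ two ⊎ N * Ω i j ≡ Y) ⊎ Ω i j ≡ 1ℚ
    edge-at-node< i j e = inv≡chord⇒node (Ω i j) (Edge.Ω-positive (isEdge⇒adj i j e)) (inv≡chord i j e)

    edge-at-node : ∀ u v → Adj G u v → (N * Ω u v ≡ two ⊎ N * Ω u v ≡ Y) ⊎ Ω u v ≡ 1ℚ
    edge-at-node u v a with orientation a
    ... | a' , b' , e , inj₁ (refl , refl) = edge-at-node< u v e
    ... | a' , b' , e , inj₂ (refl , refl) = subst (λ z → (N * z ≡ two ⊎ N * z ≡ Y) ⊎ z ≡ 1ℚ) (Ω-sym v u) (edge-at-node< v u e)

    nΩ≡NΩ : ∀ u v → ℕ→ℚ n * Ω u v ≡ N * Ω u v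
    nΩ≡NΩ u v = cong (_* Ω u v) eND

    nΩ≡2⇒adj : ∀ u v → Adj G u v → N * Ω u v ≡ two → ∀ j → ¬ j ≡ u → Adj G u j
    nΩ≡2⇒adj u v a e j ju with j FinP.≟ v
    ... | yes refl = a
    ... | no jv = Edge.nΩ≡2⇒adj-all a (trans (nΩ≡NΩ u v) e) j ju jv

    triangle⇒Ω≢1 : ∀ {u v w} → Adj G u v → Adj G u w → Adj G v w → ¬ v ≡ w → Ω u w ≡ 1ℚ → ⊥
    triangle⇒Ω≢1 {u} {v} {w} auv auw avw vw e = Edge.Ω≡1⇒no-detour auw e auv vw (cons (λ q → adj⇒≢ G auv (sym q)) avw [])

    complete-from-short-edge : ∀ u v → Adj G u v → N * Ω u v ≡ two →
      (∀ w → ¬ w ≡ u → ¬ w ≡ v → (N * Ω w u ≡ two) ⊎ (N * Ω w v ≡ two)) → IsComplete G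
    complete-from-short-edge u v a e res i j ij = univ-all i j (λ q → ij (sym q))
      where
        evu : N * Ω v u ≡ two
        evu = trans (cong (N *_) (Ω-sym v u)) e
        univ-all : ∀ w j → ¬ j ≡ w → Adj G w j
        univ-all w j jw with w FinP.≟ u
        ... | yes refl = nΩ≡2⇒adj u v a e j jw
        ... | no wu with w FinP.≟ v
        ...   | yes refl = nΩ≡2⇒adj v u (adj-sym G a) evu j jw
        ...   | no wv with res w wu wv
        ...     | inj₁ ewu = nΩ≡2⇒adj w u (adj-sym G (nΩ≡2⇒adj u v a e w wu)) ewu j jw
        ...     | inj₂ ewv = nΩ≡2⇒adj w v (adj-sym G (nΩ≡2⇒adj v u (adj-sym G a) evu w wv)) ewv j jw

    -- With Y = 2 each edge has N Ω = 2 or Ω = 1.  One short edge uv makes u and v adjacent to all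
    -- vertices, and no edge of a triangle has Ω = 1, so G is complete; otherwise no edge lies on a cycle.
    module FractionZero (ε≡0 : ε ≡ 0ℚ) where
      Y≡two : Y ≡ two
      Y≡two = trans (cong (λ z → D * z + two) ε≡0) (trans (cong (_+ two) (*-zeroʳ D)) (+-identityˡ two))

      result : IsTree G ⊎ IsComplete G
      result with search₂ (λ i j → Adj G i j × N * Ω i j ≡ two) (λ i j → adj? G i j ×-dec N * Ω i j ≟ two)
      ... | inj₁ (u , v , a , e) = inj₂ (complete-from-short-edge u v a e res)
        where
          res : ∀ w → ¬ w ≡ u → ¬ w ≡ v → (N * Ω w u ≡ two) ⊎ (N * Ω w v ≡ two)
          res w wu wv with edge-at-node u w (nΩ≡2⇒adj u v a e w wu)
          ... | inj₁ (inj₁ x) = inj₁ (trans (cong (N *_) (Ω-sym w u)) x)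
          ... | inj₁ (inj₂ x) = inj₁ (trans (cong (N *_) (Ω-sym w u)) (trans x Y≡two))
          ... | inj₂ x = ⊥-elim (triangle⇒Ω≢1 a (nΩ≡2⇒adj u v a e w wu) (nΩ≡2⇒adj v u (adj-sym G a) (trans (cong (N *_) (Ω-sym v u)) e) w wv) (λ q → wv (sym q)) x)
      ... | inj₂ noA = inj₁ (conn , noCycle)
        where
          allB : ∀ u v → Adj G u v → Ω u v ≡ 1ℚ
          allB u v a with edge-at-node u v a
          ... | inj₁ (inj₁ x) = ⊥-elim (noA u v (a , x))
          ... | inj₁ (inj₂ x) = ⊥-elim (noA u v (a , trans x Y≡two))
          ... | inj₂ x = x
          noCycle : ¬ HasCycle G
          noCycle (suc (suc L) , ℕ.s≤s (ℕ.s≤s _) , v , inj , st , cl) =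
            Cycles.closing-edge-Ω≢1 G conn Ω H L v inj st cl (allB _ _ (adj-sym G cl))

    -- Counting edges at each node with Foster's theorem and the value of Σ low shows that exactly
    -- one edge pq has N Ω = Y; both alternatives for the remaining edges are then contradictory.
    module FractionPositive (εpos : 0ℚ < ε) where
      isY isOne : Fin n → Fin n → ℚ
      isY i j = b2q (N * Ω i j ≟ Y)
      isOne i j = b2q (Ω i j ≟ 1ℚ)

      two<Y : two < Y
      two<Y = <-via-difference (D * ε) (solve 3 (λ d e t → (d :* e :+ t) :- t := d :* e) refl D ε two) (pos*pos Dpos εpos)

      Y<N : Y < N
      Y<N = <-via-difference (D * (1ℚ - ε)) (solve 3 (λ d e t → (d :+ t) :- (d :* e :+ t) := d :* (con 1ℚ :- e)) refl D ε two) (pos*pos Dpos (p<q⇒0<q-p ε1))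

      two<N : two < N
      two<N = <-trans two<Y Y<N

      ne : ∀ {a b} → a < b → ¬ a ≡ b
      ne lt e = <-irrefl e lt

      lowR NΩR : ℚ → ℚ → ℚ
      lowR p q = (Y - two) * 1ℚ + (- (Y - two)) * p + (- (Y - two)) * q
      NΩR p q = two * 1ℚ + (Y - two) * p + (N - two) * q

      EdgeCounts : Fin n → Fin n → Set
      EdgeCounts i j = (Z i j ≡ lowR (isY i j) (isOne i j)) × (N * Ω i j ≡ NΩR (isY i j) (isOne i j))

      short-edge-counts : ∀ i j → N * Ω i j ≡ two → EdgeCounts i j
      short-edge-counts i j x =
        trans (lowGap-low (Ω i j) ge) (trans (cong (λ z → Y - z) x)
          (trans (solve 2 (λ y t → y :- t := (y :- t) :* con 1ℚ :+ (:- (y :- t)) :* con 0ℚ :+ (:- (y :- t)) :* con 0ℚ) refl Y two)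
            (sym (cong₂ lowR iy0 ib0)))) ,
        trans x (trans (solve 3 (λ y t n → t := t :* con 1ℚ :+ (y :- t) :* con 0ℚ :+ (n :- t) :* con 0ℚ) refl Y two N)
            (sym (cong₂ NΩR iy0 ib0)))
        where
          iy0 : isY i j ≡ 0ℚ
          iy0 = b2q-no (N * Ω i j ≟ Y) (λ q → ne two<Y (trans (sym x) q))
          ib0 : isOne i j ≡ 0ℚ
          ib0 = b2q-no (Ω i j ≟ 1ℚ) (λ q → ne two<N (trans (sym x) (trans (cong (N *_) q) (*-identityʳ N))))
          ge : 0ℚ ≤ Y - N * Ω i j
          ge = subst (λ z → 0ℚ ≤ Y - z) (sym x) (p≤q⇒0≤q-p (<⇒≤ two<Y))

      Y-edge-counts : ∀ i j → N * Ω i j ≡ Y → EdgeCounts i j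
      Y-edge-counts i j x =
        trans (lowGap-high (Ω i j) le)
          (trans (solve 2 (λ y t → con 0ℚ := (y :- t) :* con 1ℚ :+ (:- (y :- t)) :* con 1ℚ :+ (:- (y :- t)) :* con 0ℚ) refl Y two)
            (sym (cong₂ lowR iy1 ib0))) ,
        trans x (trans (solve 3 (λ y t n → y := t :* con 1ℚ :+ (y :- t) :* con 1ℚ :+ (n :- t) :* con 0ℚ) refl Y two N)
            (sym (cong₂ NΩR iy1 ib0)))
        where
          iy1 : isY i j ≡ 1ℚ
          iy1 = b2q-yes (N * Ω i j ≟ Y) x
          ib0 : isOne i j ≡ 0ℚ
          ib0 = b2q-no (Ω i j ≟ 1ℚ) (λ q → ne Y<N (trans (sym x) (trans (cong (N *_) q) (*-identityʳ N))))
          le : Y - N * Ω i j ≤ 0ℚ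
          le = ≤-reflexive (trans (cong (λ z → Y - z) x) (+-inverseʳ Y))

      unit-edge-counts : ∀ i j → Ω i j ≡ 1ℚ → EdgeCounts i j
      unit-edge-counts i j x =
        trans (lowGap-high (Ω i j) le)
          (trans (solve 2 (λ y t → con 0ℚ := (y :- t) :* con 1ℚ :+ (:- (y :- t)) :* con 0ℚ :+ (:- (y :- t)) :* con 1ℚ) refl Y two)
            (sym (cong₂ lowR iy0 ib1))) ,
        trans (cong (N *_) x) (trans (solve 3 (λ y t n → n :* con 1ℚ := t :* con 1ℚ :+ (y :- t) :* con 0ℚ :+ (n :- t) :* con 1ℚ) refl Y two N)
            (sym (cong₂ NΩR iy0 ib1)))
        where
          NΩ≡N : N * Ω i j ≡ N
          NΩ≡N = trans (cong (N *_) x) (*-identityʳ N)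
          iy0 : isY i j ≡ 0ℚ
          iy0 = b2q-no (N * Ω i j ≟ Y) (λ q → ne Y<N (trans (sym q) NΩ≡N))
          ib1 : isOne i j ≡ 1ℚ
          ib1 = b2q-yes (Ω i j ≟ 1ℚ) x
          le : Y - N * Ω i j ≤ 0ℚ
          le = subst (λ z → Y - z ≤ 0ℚ) (sym NΩ≡N) (<⇒≤ (p<q⇒p-q<0 Y<N))

      per-edge : ∀ i j → Adj G i j → EdgeCounts i j
      per-edge i j a with edge-at-node i j a
      ... | inj₁ (inj₁ x) = short-edge-counts i j x
      ... | inj₁ (inj₂ x) = Y-edge-counts i j x
      ... | inj₂ x = unit-edge-counts i j x

      #Y #One : ℚ
      #Y = edgeSum isY
      #One = edgeSum isOne

      Σlow≡counts : edgeSum Z ≡ (Y - two) * m + (- (Y - two)) * #Y + (- (Y - two)) * #One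
      Σlow≡counts = trans (edgeSum-cong Z (λ i j → lowR (isY i j) (isOne i j)) (λ i j a → proj₁ (per-edge i j a)))
                   (edgeSum-affine (Y - two) (- (Y - two)) (- (Y - two)) isY isOne)

      NS1≡counts : N * S1 ≡ two * m + (Y - two) * #Y + (N - two) * #One
      NS1≡counts = trans (sym (edgeSum-*ˡ N Ω)) (trans (edgeSum-cong (λ i j → N * Ω i j) (λ i j → NΩR (isY i j) (isOne i j)) (λ i j a → proj₂ (per-edge i j a)))
                   (edgeSum-affine two (Y - two) (N - two) isY isOne))

      e1 : kq + 1ℚ - #Y - #One ≡ 0ℚ
      e1 = mul-cancelˡ-≡ {c = D * ε} (λ z → <-irrefl (sym z) (pos*pos Dpos εpos))
             (trans (trans (solve 7 (λ d e t m k cy cb → d :* e :* (k :+ con 1ℚ :- cy :- cb)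
                         := ((d :* e :+ t) :- t) :* m :+ (:- ((d :* e :+ t) :- t)) :* cy :+ (:- ((d :* e :+ t) :- t)) :* cb :- d :* e :* (m :- k :- con 1ℚ))
                       refl D ε two m kq #Y #One)
                    (p≡q⇒p-q≡0 (trans (sym Σlow≡counts) Σlow≡)))
               (sym (*-zeroʳ (D * ε))))

      e2 : two * m + (Y - two) * #Y + (N - two) * #One - N * (N - 1ℚ) ≡ 0ℚ
      e2 = p≡q⇒p-q≡0 (trans (sym NS1≡counts) (cong (N *_) S1≡N-1))

      #Y≡1 : #Y ≡ 1ℚ
      #Y≡1 = p-q≡0⇒p≡q (mul-cancelˡ-≡ {c = D * (1ℚ - ε)} (λ z → <-irrefl (sym z) (pos*pos Dpos (p<q⇒0<q-p ε1)))
        (begin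
          D * (1ℚ - ε) * (#Y - 1ℚ)
            ≡⟨ solve 7 (λ d e t m k cy cb → d :* (con 1ℚ :- e) :* (cy :- con 1ℚ)
                 := ((k :+ e) :* d :- ((d :+ t) :* (d :+ t) :- (d :+ t) :- t :* m))
                    :- (t :* m :+ ((d :* e :+ t) :- t) :* cy :+ ((d :+ t) :- t) :* cb :- (d :+ t) :* ((d :+ t) :- con 1ℚ))
                    :- d :* (k :+ con 1ℚ :- cy :- cb)) refl D ε two m kq #Y #One ⟩
          R0 - (two * m + (Y - two) * #Y + (N - two) * #One - N * (N - 1ℚ)) - D * (kq + 1ℚ - #Y - #One)
            ≡⟨ cong₂ (λ a b → a - b - D * (kq + 1ℚ - #Y - #One)) R0≡0 e2 ⟩
          0ℚ - 0ℚ - D * (kq + 1ℚ - #Y - #One)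
            ≡⟨ cong (λ a → 0ℚ - 0ℚ - D * a) e1 ⟩
          0ℚ - 0ℚ - D * 0ℚ
            ≡⟨ solve 2 (λ d e → con 0ℚ :- con 0ℚ :- d :* con 0ℚ := d :* (con 1ℚ :- e) :* con 0ℚ) refl D ε ⟩
          D * (1ℚ - ε) * 0ℚ ∎))

      iY'-nn : ∀ i j → Adj G i j → 0ℚ ≤ isY i j
      iY'-nn i j _ = h (N * Ω i j ≟ Y)
        where h : ∀ {A : Set} (d : Dec A) → 0ℚ ≤ b2q d
              h (yes _) = *≤* (ℤ.+≤+ ℕ.z≤n)
              h (no _) = ≤-refl

      Y-sym : ∀ u v → N * Ω u v ≡ Y → N * Ω v u ≡ Y
      Y-sym u v e = trans (cong (N *_) (Ω-sym v u)) e

      one-Y-edge : ∀ {u v u' v'} → Adj G u v → Adj G u' v' → N * Ω u v ≡ Y → N * Ω u' v' ≡ Y →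
             ¬ ((u ≡ u' × v ≡ v') ⊎ (u ≡ v' × v ≡ u')) → ⊥
      one-Y-edge {u} {v} {u'} {v'} a a' y y' dist with orientation a | orientation a'
      ... | a1 , b1 , e1 , o1 | a2 , b2 , e2 , o2 =
          <-irrefl refl (<-≤-trans (*<* (ℤ.+<+ (ℕ.s≤s (ℕ.s≤s ℕ.z≤n))))
             (subst₂ _≤_ (cong₂ _+_ (b2q-yes (N * Ω a1 b1 ≟ Y) (yab o1 y)) (b2q-yes (N * Ω a2 b2 ≟ Y) (yab o2 y')))
                #Y≡1 (edgeSum-two-terms isY iY'-nn a1 b1 a2 b2 e1 e2 nd)))
        where
          yab : ∀ {p q a b} → ((a ≡ p × b ≡ q) ⊎ (a ≡ q × b ≡ p)) → N * Ω p q ≡ Y → N * Ω a b ≡ Y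
          yab {p} {q} (inj₁ (refl , refl)) e = e
          yab {p} {q} (inj₂ (refl , refl)) e = Y-sym p q e
          nd' : ∀ {x1 y1 x2 y2} → ((x1 ≡ u × y1 ≡ v) ⊎ (x1 ≡ v × y1 ≡ u)) → ((x2 ≡ u' × y2 ≡ v') ⊎ (x2 ≡ v' × y2 ≡ u')) →
                ¬ (x1 ≡ x2 × y1 ≡ y2)
          nd' (inj₁ (refl , refl)) (inj₁ (refl , refl)) (refl , refl) = dist (inj₁ (refl , refl))
          nd' (inj₁ (refl , refl)) (inj₂ (refl , refl)) (refl , refl) = dist (inj₂ (refl , refl))
          nd' (inj₂ (refl , refl)) (inj₁ (refl , refl)) (refl , refl) = dist (inj₂ (refl , refl))
          nd' (inj₂ (refl , refl)) (inj₂ (refl , refl)) (refl , refl) = dist (inj₁ (refl , refl))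
          nd : ¬ (a1 ≡ a2 × b1 ≡ b2)
          nd = nd' o1 o2

      existsY : Σ (Fin n) λ p → Σ (Fin n) λ q → Adj G p q × N * Ω p q ≡ Y
      existsY with search₂ (λ i j → Adj G i j × N * Ω i j ≡ Y) (λ i j → adj? G i j ×-dec N * Ω i j ≟ Y)
      ... | inj₁ r = r
      ... | inj₂ none = ⊥-elim (1≢0 (trans (sym #Y≡1) (trans (edgeSum-cong isY (λ _ _ → 0ℚ) (λ i j a → b2q-no (N * Ω i j ≟ Y) (λ y → none i j (a , y)))) edgeSum-0)))

      p q : Fin n
      p = proj₁ existsY
      q = proj₁ (proj₂ existsY)

      apq : Adj G p q
      apq = proj₁ (proj₂ (proj₂ existsY))

      NΩpq≡Y : N * Ω p q ≡ Y
      NΩpq≡Y = proj₂ (proj₂ (proj₂ existsY))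

      -- A short edge makes G complete, where every N Ω is 2, but N Ω p q = Y > 2.
      no-short-edge : ∀ u v → Adj G u v → N * Ω u v ≡ two → ⊥
      no-short-edge u v a e = ne two<Y (trans (sym (trans (cong (_* Ω p q) (sym eND)) (CompleteGraph.complete⇒nΩ≡2 G conn Ω H comp Npos' (adj⇒≢ G apq)))) NΩpq≡Y)
        where
          Npos' : 0ℚ < ℕ→ℚ n
          Npos' = subst (0ℚ <_) (sym eND) Npos
          evu : N * Ω v u ≡ two
          evu = trans (cong (N *_) (Ω-sym v u)) e
          res : ∀ w → ¬ w ≡ u → ¬ w ≡ v → (N * Ω w u ≡ two) ⊎ (N * Ω w v ≡ two)
          res w wu wv = r1 (edge-at-node u w auw)
            where
              auw : Adj G u w
              auw = nΩ≡2⇒adj u v a e w wu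
              avw : Adj G v w
              avw = nΩ≡2⇒adj v u (adj-sym G a) evu w wv
              r1 : (N * Ω u w ≡ two ⊎ N * Ω u w ≡ Y) ⊎ Ω u w ≡ 1ℚ → (N * Ω w u ≡ two) ⊎ (N * Ω w v ≡ two)
              r1 (inj₁ (inj₁ x)) = inj₁ (trans (cong (N *_) (Ω-sym w u)) x)
              r1 (inj₂ x) = ⊥-elim (triangle⇒Ω≢1 a auw avw (λ q → wv (sym q)) x)
              r1 (inj₁ (inj₂ yu)) = r2 (edge-at-node v w avw)
                where
                  r2 : (N * Ω v w ≡ two ⊎ N * Ω v w ≡ Y) ⊎ Ω v w ≡ 1ℚ → (N * Ω w u ≡ two) ⊎ (N * Ω w v ≡ two)
                  r2 (inj₁ (inj₁ x)) = inj₂ (trans (cong (N *_) (Ω-sym w v)) x)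
                  r2 (inj₂ x) = ⊥-elim (triangle⇒Ω≢1 (adj-sym G a) avw auw (λ q → wu (sym q)) x)
                  r2 (inj₁ (inj₂ yv)) = ⊥-elim (one-Y-edge auw avw yu yv dist)
                    where
                      dist : ¬ ((u ≡ v × w ≡ w) ⊎ (u ≡ w × w ≡ v))
                      dist (inj₁ (uv , _)) = adj⇒≢ G a uv
                      dist (inj₂ (uw , _)) = wu (sym uw)
          comp : IsComplete G
          comp = complete-from-short-edge u v a e res

      -- As Ω p q < 1, pq lies on a cycle; the next edge of that cycle sits at no node.
      impossible : ⊥
      impossible = r (edge-at-node p j1 a1)
        where
          lt1 : Ω p q < 1ℚ
          lt1 = *-cancelˡ-<-nonNeg N {{ℚ.nonNegative (<⇒≤ Npos)}} (subst₂ _<_ (sym NΩpq≡Y) (sym (*-identityʳ N)) Y<N)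
          open DescendingPaths G conn Ω H
          module C = CycleThroughEdge apq lt1
          j1 : Fin n
          j1 = C.j1
          a1 : Adj G p j1
          a1 = C.a1
          r : (N * Ω p j1 ≡ two ⊎ N * Ω p j1 ≡ Y) ⊎ Ω p j1 ≡ 1ℚ → ⊥
          r (inj₁ (inj₁ x)) = no-short-edge p j1 a1 x
          r (inj₂ x) = C.second-edge-Ω≢1 (trans (Ω-sym j1 p) x)
          r (inj₁ (inj₂ x)) = one-Y-edge apq a1 NΩpq≡Y x dist
            where
              dist : ¬ ((p ≡ p × q ≡ j1) ⊎ (p ≡ j1 × q ≡ p))
              dist (inj₁ (_ , qj)) = C.j1t (sym qj)
              dist (inj₂ (pj , _)) = adj⇒≢ G a1 pj

module Main (k0 : ℕ) (G : Graph (suc (suc (suc k0)))) (conn : Connected G)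
            (Ω : Fin (suc (suc (suc k0))) → Fin (suc (suc (suc k0))) → ℚ)
            (H : IsEffectiveResistance G Ω) where
  n : ℕ
  n = suc (suc (suc k0))
  g : Fin n
  g = Fin.zero
  m' : ℕ
  m' = edgeCount G

  open Laplacian G
  open Resistance G conn Ω H
  open EdgeSum G
  open Foster G conn Ω H g
  open CauchySchwarz G conn Ω H

  D : ℚ
  D = ℕ→ℚ (suc k0)
  Dpos : 0ℚ < D
  Dpos = ℕ→ℚ-mono-< {0} {suc k0} (ℕ.s≤s ℕ.z≤n)

  eND : ℕ→ℚ n ≡ D + two
  eND = trans (cong ℕ→ℚ (ℕP.+-comm 2 (suc k0))) (ℕ→ℚ-+ (suc k0) 2)

  q : ℚ
  q = Bounds.q n m'
  k : ℤ
  k = floor q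
  ε : ℚ
  ε = Bounds.ε n m'

  ε0 : 0ℚ ≤ ε
  ε0 = p≤q⇒0≤q-p (floor-low q)

  ε1 : ε < 1ℚ
  ε1 = subst₂ _<_ refl (solve 2 (λ k o → k :+ o :- k := o) refl (ℤ→ℚ k) 1ℚ) (+-mono-<-≤ (floor-high q) (≤-refl { - ℤ→ℚ k}))

  mQ≡ : ℕ→ℚ m' ≡ m
  mQ≡ = edgeCount≡

  open ChordBound D ε Dpos ε0 ε1
  open UpperBound G conn Ω H g D ε Dpos ε0 ε1 eND k

  qD : q * D ≡ N * N - N - two * m
  qD = begin
    q * D  ≡⟨ fracℤ-mul (ℤ.+ (n ℕ.* n) ℤ.- ℤ.+ n ℤ.- ℤ.+ (2 ℕ.* m')) k0 ⟩
    ℤ→ℚ (ℤ.+ (n ℕ.* n) ℤ.- ℤ.+ n ℤ.- ℤ.+ (2 ℕ.* m'))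
      ≡⟨ trans (ℤ→ℚ-- (ℤ.+ (n ℕ.* n) ℤ.- ℤ.+ n) (ℤ.+ (2 ℕ.* m'))) (cong₂ _-_ (ℤ→ℚ-- (ℤ.+ (n ℕ.* n)) (ℤ.+ n)) refl) ⟩
    ℕ→ℚ (n ℕ.* n) - ℕ→ℚ n - ℕ→ℚ (2 ℕ.* m')
      ≡⟨ cong₃' (ℕ→ℚ-* n n) (ℕ→ℚ-* 2 m') ⟩
    ℕ→ℚ n * ℕ→ℚ n - ℕ→ℚ n - two * ℕ→ℚ m'
      ≡⟨ cong₂ (λ a b → a * a - a - two * b) eND mQ≡ ⟩
    N * N - N - two * m ∎
    where
      cong₃' : ∀ {a a' b b'} → a ≡ a' → b ≡ b' → a - ℕ→ℚ n - b ≡ a' - ℕ→ℚ n - b'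
      cong₃' refl refl = refl

  rel : (kq + ε) * D ≡ N * N - N - two * m
  rel = trans (cong (_* D) (solve 2 (λ k q → k :+ (q :- k) := q) refl (ℤ→ℚ k) q)) qD

  C : ℚ
  C = cyclicity G Ω

  C≡ : C ≡ S2 - m
  C≡ = edgeSum-- inv (λ _ _ → 1ℚ)

  c : ℚ
  c = ℕ→ℚ (suc (suc k0))

  c≡ : c ≡ N - 1ℚ
  c≡ = trans (cong ℕ→ℚ (ℕP.+-comm 1 (suc k0))) (trans (ℕ→ℚ-+ (suc k0) 1)
         (solve 1 (λ d → d :+ con 1ℚ := d :+ con two :- con 1ℚ) refl D))

  cpos : 0ℚ < c
  cpos = ℕ→ℚ-mono-< {0} {suc (suc k0)} (ℕ.s≤s ℕ.z≤n)

  S1≡c : S1 ≡ c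
  S1≡c = trans foster (trans (cong (_- 1ℚ) eND) (sym c≡))

  lowerQ : ℚ
  lowerQ = Bounds.lower n m'

  lower-c : lowerQ * c ≡ m * (m - N + 1ℚ)
  lower-c = begin
    lowerQ * c ≡⟨ fracℤ-mul (ℤ.+ m' ℤ.* (ℤ.+ m' ℤ.- ℤ.+ n ℤ.+ ℤ.+ 1)) (suc k0) ⟩
    ℤ→ℚ (ℤ.+ m' ℤ.* (ℤ.+ m' ℤ.- ℤ.+ n ℤ.+ ℤ.+ 1))
      ≡⟨ trans (ℤ→ℚ-* (ℤ.+ m') (ℤ.+ m' ℤ.- ℤ.+ n ℤ.+ ℤ.+ 1)) (cong (ℤ→ℚ (ℤ.+ m') *_) (trans (ℤ→ℚ-+ (ℤ.+ m' ℤ.- ℤ.+ n) (ℤ.+ 1)) (cong (_+ 1ℚ) (ℤ→ℚ-- (ℤ.+ m') (ℤ.+ n))))) ⟩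
    ℕ→ℚ m' * (ℕ→ℚ m' - ℕ→ℚ n + 1ℚ)
      ≡⟨ cong₂ (λ a b → a * (a - b + 1ℚ)) mQ≡ eND ⟩
    m * (m - N + 1ℚ) ∎

  cauchy-schwarz-gap : c * (C - lowerQ) ≡ S1 * S2 - m * m
  cauchy-schwarz-gap = begin
    c * (C - lowerQ) ≡⟨ solve 3 (λ c x l → c :* (x :- l) := c :* x :- l :* c) refl c C lowerQ ⟩
    c * C - lowerQ * c ≡⟨ cong₂ (λ a b → c * a - b) C≡ lower-c ⟩
    c * (S2 - m) - m * (m - N + 1ℚ) ≡⟨ cong (λ z → z * (S2 - m) - m * (m - N + 1ℚ)) c≡ ⟩
    (N - 1ℚ) * (S2 - m) - m * (m - N + 1ℚ) ≡⟨ solve 3 (λ n s m → (n :- con 1ℚ) :* (s :- m) :- m :* (m :- n :+ con 1ℚ) := (n :- con 1ℚ) :* s :- m :* m) refl N S2 m ⟩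
    (N - 1ℚ) * S2 - m * m ≡⟨ cong (λ z → z * S2 - m * m) (trans (sym c≡) (sym S1≡c)) ⟩
    S1 * S2 - m * m ∎

  lower-bound : lowerQ ≤ C
  lower-bound = 0≤q-p⇒p≤q (mul-cancelˡ-≤ {c = c} cpos (subst₂ _≤_ (sym (*-zeroʳ c)) (sym cauchy-schwarz-gap) (p≤q⇒0≤q-p cauchy-schwarz)))

  edge-equivalent-from-oriented : (∀ i j k l → isEdge< G i j ≡ true → isEdge< G k l ≡ true → Ω i j ≡ Ω k l) → EdgeEquivalent G Ω
  edge-equivalent-from-oriented h u v x y a b with orientation a | orientation b
  ... | a1 , b1 , e1 , o1 | a2 , b2 , e2 , o2 = trans (sym (fix o1)) (trans (h a1 b1 a2 b2 e1 e2) (fix o2))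
    where
      fix : ∀ {p q a' b'} → ((a' ≡ p × b' ≡ q) ⊎ (a' ≡ q × b' ≡ p)) → Ω a' b' ≡ Ω p q
      fix (inj₁ (refl , refl)) = refl
      fix {p} {q} (inj₂ (refl , refl)) = Ω-sym q p

  lower-bound-tight : (lowerQ ≡ C) ⇔ EdgeEquivalent G Ω
  lower-bound-tight = mk⇔ to from
    where
      to : lowerQ ≡ C → EdgeEquivalent G Ω
      to e = edge-equivalent-from-oriented (cauchy-schwarz-equality⇒ (sym (p-q≡0⇒p≡q (trans (sym cauchy-schwarz-gap) (trans (cong (λ z → c * (C - z)) e) (trans (cong (c *_) (+-inverseʳ C)) (*-zeroʳ c)))))))
      from : EdgeEquivalent G Ω → lowerQ ≡ C
      from ee = sym (p-q≡0⇒p≡q (mul-cancelˡ-≡ {c = c} (λ z → <-irrefl (sym z) cpos)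
                  (trans cauchy-schwarz-gap (trans (p≡q⇒p-q≡0 (sym (cauchy-schwarz-equality⇐ ee))) (sym (*-zeroʳ c))))))

  upperQ : ℚ
  upperQ = Bounds.upper n m'

  upper' : ℚ
  upper' = N * iY + (m * N - N * N + D * ε) * ½

  upper≡ : upperQ ≡ upper'
  upper≡ = cong₂ (λ a b → a * iY + (b * a - a * a + D * ε) * ½) eND mQ≡

  open Quotient rel

  chord-gap : upperQ - C ≡ upper+m - S2
  chord-gap = trans (cong₂ _-_ upper≡ C≡) (solve 3 (λ u s m → u :- (s :- m) := (u :+ m) :- s) refl upper' S2 m)

  upper-bound : C ≤ upperQ
  upper-bound = 0≤q-p⇒p≤q (subst (0ℚ ≤_) (sym chord-gap) (p≤q⇒0≤q-p S2≤upper+m))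

  eqU-of : C ≡ upperQ → S2 ≡ upper+m
  eqU-of e = sym (p-q≡0⇒p≡q (trans (sym chord-gap) (p≡q⇒p-q≡0 (sym e))))

  open UpperBoundEquality G conn Ω H g D ε Dpos ε0 ε1 eND k

  upper-tight⇒tree⊎complete : C ≡ upperQ → IsTree G ⊎ IsComplete G
  upper-tight⇒tree⊎complete e with ≤⇒<⊎≡ ε0
  ... | inj₂ z = Tight.FractionZero.result rel (eqU-of e) (sym z)
  ... | inj₁ p = ⊥-elim (Tight.FractionPositive.impossible rel (eqU-of e) p)

  0≤z<1⇒z≡0 : ∀ w → 0ℚ ≤ ℤ→ℚ w → ℤ→ℚ w < 1ℚ → ℤ→ℚ w ≡ 0ℚ
  0≤z<1⇒z≡0 w p q = h w (ℤ→ℚ-cancel-≤ {ℤ.+ 0} {w} p) (ℤ→ℚ-cancel-< {w} {ℤ.+ 1} q)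
    where
      h : ∀ w → ℤ.+ 0 ℤ.≤ w → w ℤ.< ℤ.+ 1 → ℤ→ℚ w ≡ 0ℚ
      h (ℤ.+ 0) _ _ = refl
      h (ℤ.+ suc n) _ (ℤ.+<+ (ℕ.s≤s ()))

  q-integral⇒ε≡0 : ∀ z → q ≡ ℤ→ℚ z → ε ≡ 0ℚ
  q-integral⇒ε≡0 z e = trans ε≡ (0≤z<1⇒z≡0 (z ℤ.- k) (subst (0ℚ ≤_) ε≡ ε0) (subst (_< 1ℚ) ε≡ ε1))
    where
      ε≡ : ε ≡ ℤ→ℚ (z ℤ.- k)
      ε≡ = trans (cong (_- ℤ→ℚ k) e) (sym (ℤ→ℚ-- z k))

  iY-of-ε0 : ε ≡ 0ℚ → iY ≡ ½
  iY-of-ε0 e = trans (cong (λ z → invℚ (D * z + two)) e)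
                 (trans (cong invℚ (trans (cong (_+ two) (*-zeroʳ D)) (+-identityˡ two))) (invℚ-unique two ½ two*½≡1))

  D≢0 : ¬ D ≡ 0ℚ
  D≢0 z = <-irrefl (sym z) Dpos

  q-cancel : ∀ r → q * D ≡ r * D → q ≡ r
  q-cancel r e = mul-cancelˡ-≡ {c = D} D≢0 (trans (*-comm D q) (trans e (*-comm r D)))

  tree⇒upper-tight : IsTree G → C ≡ upperQ
  tree⇒upper-tight (_ , noCyc) = trans C≡ (trans C0 (sym (trans upper≡ U0)))
    where
      open DescendingPaths G conn Ω H
      allOne : ∀ u v → Adj G u v → Ω u v ≡ 1ℚ
      allOne u v a = ≤-antisym (Edge.Ω≤1 a) (≮⇒≥ (λ lt → noCyc (CycleThroughEdge.edge-on-cycle a lt)))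
      S1m : S1 ≡ m
      S1m = edgeSum-cong Ω (λ _ _ → 1ℚ) allOne
      S2m : S2 ≡ m
      S2m = edgeSum-cong inv (λ _ _ → 1ℚ) (λ u v a → trans (cong invℚ (allOne u v a)) (invℚ-unique 1ℚ 1ℚ refl))
      mc : m ≡ N - 1ℚ
      mc = trans (sym S1m) (trans S1≡c c≡)
      C0 : S2 - m ≡ 0ℚ
      C0 = trans (cong (_- m) S2m) (+-inverseʳ m)
      qc : q ≡ ℤ→ℚ (ℤ.+ suc (suc k0))
      qc = q-cancel c (trans qD (trans (cong (λ z → N * N - N - two * z) mc)
             (trans (solve 2 (λ d t → (d :+ t) :* (d :+ t) :- (d :+ t) :- t :* ((d :+ t) :- con 1ℚ)
                                  := ((d :+ t) :- con 1ℚ) :* d) refl D two)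
               (cong (_* D) (sym c≡)))))
      ε≡0 : ε ≡ 0ℚ
      ε≡0 = q-integral⇒ε≡0 (ℤ.+ suc (suc k0)) qc
      U0 : upper' ≡ 0ℚ
      U0 = trans (cong₃ (iY-of-ε0 ε≡0) mc ε≡0)
             (solve 3 (λ n h d → n :* h :+ ((n :- con 1ℚ) :* n :- n :* n :+ d :* con 0ℚ) :* h := con 0ℚ) refl N ½ D)
        where
          cong₃ : ∀ {a a' b b' e e'} → a ≡ a' → b ≡ b' → e ≡ e' → N * a + (b * N - N * N + D * e) * ½ ≡ N * a' + (b' * N - N * N + D * e') * ½
          cong₃ refl refl refl = refl

  complete⇒upper-tight : IsComplete G → C ≡ upperQ
  complete⇒upper-tight comp = trans C≡ (trans CU (sym upper≡))
    where
      Npos' : 0ℚ < ℕ→ℚ n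
      Npos' = subst (0ℚ <_) (sym eND) Npos
      NΩ2 : ∀ u v → Adj G u v → N * Ω u v ≡ two
      NΩ2 u v a = trans (cong (_* Ω u v) (sym eND)) (CompleteGraph.complete⇒nΩ≡2 G conn Ω H comp Npos' (adj⇒≢ G a))
      invΩ : ∀ u v → Adj G u v → inv u v ≡ (N * ½) * 1ℚ
      invΩ u v a = trans (invℚ-unique (Ω u v) (N * ½)
                     (trans (solve 3 (λ x n h → x :* (n :* h) := (n :* x) :* h) refl (Ω u v) N ½) (trans (cong (_* ½) (NΩ2 u v a)) two*½≡1)))
                     (sym (*-identityʳ (N * ½)))
      S2≡ : S2 ≡ (N * ½) * m
      S2≡ = trans (edgeSum-cong inv (λ _ _ → (N * ½) * 1ℚ) invΩ) (edgeSum-*ˡ (N * ½) (λ _ _ → 1ℚ))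
      NS1 : N * S1 ≡ two * m
      NS1 = trans (sym (edgeSum-*ˡ N Ω)) (trans (edgeSum-cong (λ i j → N * Ω i j) (λ _ _ → two * 1ℚ) (λ i j a → trans (NΩ2 i j a) (sym (*-identityʳ two)))) (edgeSum-*ˡ two (λ _ _ → 1ℚ)))
      R1 : N * N - N - two * m ≡ 0ℚ
      R1 = trans (solve 2 (λ n t → n :* n :- n :- t := n :* (n :- con 1ℚ) :- t) refl N (two * m))
             (p≡q⇒p-q≡0 (trans (cong (N *_) (sym S1≡N-1)) NS1))
      q0 : q ≡ ℤ→ℚ (ℤ.+ 0)
      q0 = q-cancel 0ℚ (trans qD (trans R1 (sym (*-zeroˡ D))))
      ε≡0 : ε ≡ 0ℚ
      ε≡0 = q-integral⇒ε≡0 (ℤ.+ 0) q0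
      CU : S2 - m ≡ upper'
      CU = p-q≡0⇒p≡q (begin
        S2 - m - upper'
          ≡⟨ cong₂ (λ a b → a - m - (N * b + (m * N - N * N + D * ε) * ½)) S2≡ (iY-of-ε0 ε≡0) ⟩
        (N * ½) * m - m - (N * ½ + (m * N - N * N + D * ε) * ½)
          ≡⟨ cong (λ z → (N * ½) * m - m - (N * ½ + (m * N - N * N + D * z) * ½)) ε≡0 ⟩
        (N * ½) * m - m - (N * ½ + (m * N - N * N + D * 0ℚ) * ½)
          ≡⟨ solve 5 (λ n h m d t → (n :* h) :* m :- m :- (n :* h :+ (m :* n :- n :* n :+ d :* con 0ℚ) :* h)
                  := h :* (n :* n :- n :- t :* m) :+ m :* (t :* h :- con 1ℚ)) refl N ½ m D two ⟩
        ½ * (N * N - N - two * m) + m * (two * ½ - 1ℚ)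
          ≡⟨ cong₂ (λ a b → ½ * a + m * (b - 1ℚ)) R1 two*½≡1 ⟩
        ½ * 0ℚ + m * (1ℚ - 1ℚ)
          ≡⟨ solve 2 (λ h m → h :* con 0ℚ :+ m :* (con 1ℚ :- con 1ℚ) := con 0ℚ) refl ½ m ⟩
        0ℚ ∎)

  upper-bound-tight : (C ≡ upperQ) ⇔ (IsTree G ⊎ IsComplete G)
  upper-bound-tight = mk⇔ upper-tight⇒tree⊎complete (λ { (inj₁ t) → tree⇒upper-tight t ; (inj₂ c') → complete⇒upper-tight c' })

mainTheorem14 : (n : ℕ) → 3 ℕ.≤ n → (G : Graph n) → Connected G →
    (Ω : Fin n → Fin n → ℚ) → IsEffectiveResistance G Ω →
    (Bounds.lower n (edgeCount G) ≤ cyclicity G Ω) ×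
    (cyclicity G Ω ≤ Bounds.upper n (edgeCount G)) ×
    ((Bounds.lower n (edgeCount G) ≡ cyclicity G Ω) ⇔ EdgeEquivalent G Ω) ×
    ((cyclicity G Ω ≡ Bounds.upper n (edgeCount G)) ⇔ (IsTree G ⊎ IsComplete G))
mainTheorem14 (suc (suc (suc k))) (ℕ.s≤s (ℕ.s≤s (ℕ.s≤s ℕ.z≤n))) G conn Ω H =
  lower-bound , upper-bound , lower-bound-tight , upper-bound-tight
  where open Main k G conn Ω H
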